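{- Let $G$ be a daisy with base hole $C$. Then: (1) $G$ is even-wheel-free if and only if every vertex of $C$ that is the centre of a petal has an odd number of neighbours in that petal. (2) $G$ is even-hole-free if and only if $G$ is even-wheel-free, $C$ has odd length, and every external sector (of every wheel $W_i$ associated with a petal) has odd length. (3) $G$ is bipartite if and only if $C$ has even length and every external sector has even length.
   Context: Graphs are finite and simple; a path means an induced path; the length of a path or cycle is its number of edges. A hole is a chordless cycle of length at least $4$. A wheel $(H,c)$ is a hole $H$ with a vertex $c$ having at least three neighbours in $H$; it is even if $c$ has an even number of neighbours in $H$; a sector of $(H,c)$ is a subpath of $H$ of length at least $1$ whose ends are adjacent to $c$ and whose internal vertices are not. For a hole $C=c_1\dots c_kc_1$ (indices mod $k$), a petal with respect to $C$ is a path $P=x\dots y$ disjoint from $C$ such that for some $i$: $x$ is adjacent to $c_{i-1}$, $y$ to $c_{i+1}$, $c_i$ is adjacent to at least one internal vertex of $P$, no edge of $c_{i-1}xPyc_{i+1}$ has both ends adjacent to $c_i$, and no other edges between $P$ and $C$; $c_i$ is its centre. A daisy is a hole $C$ (its base hole) with petals with respect to $C$, no two with the same centre, whose centres induce a (possibly empty) subpath of $C$ or all of $C$, with no edges other than those of $C$, the petals, and between petals and $C$ as described. For the petal $P_i=x_i\dots y_i$ centred at $c_i$, let $Q_i$ be the path of $C$ from $c_{i-1}$ to $c_{i+1}$ not containing $c_i$, $H_i$ the hole formed by $P_i$ and $Q_i$, and $W_i=(H_i,c_i)$; the external sectors of $W_i$ are the sectors of $W_i$ that are subpaths of $c_{i-1}x_iP_iy_ic_{i+1}$.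 -}

module Defs where

open import Data.Nat using (ℕ; zero; suc; _+_; _∸_; _≤_; _<_; _≡ᵇ_; _<?_; s≤s; z≤n; NonZero)
open import Data.Nat.DivMod using (_mod_)
open import Data.Nat.Divisibility using (_∣_)
open import Data.Fin using (Fin; toℕ; fromℕ<)
open import Data.Bool using (Bool; true; false; T; _∧_; _∨_; not)
open import Data.List using (List; length; filterᵇ; allFin)
open import Data.Sum using (_⊎_; inj₁; inj₂)
open import Data.Product using (Σ; Σ-syntax; ∃; _×_; _,_)
open import Relation.Nullary using (¬_; yes; no)
open import Relation.Binary.PropositionalEquality using (_≡_; _≢_)
open import Function.Definitions using (Injective)

Even : ℕ → Set
Even n = 2 ∣ n

Odd : ℕ → Set
Odd n = ¬ Even n

-- Graphs: a vertex type with a Boolean adjacency relation.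
-- (All graphs used below are finite and simple: the daisy construction
--  produces a finite vertex type and a symmetric, loop-free adjacency.)

record Graph : Set₁ where
  field
    V   : Set
    adj : V → V → Bool

open Graph public

cycAdj : ℕ → ℕ → ℕ → Bool
cycAdj m a b = (suc a ≡ᵇ b) ∨ (suc b ≡ᵇ a)
             ∨ ((a ≡ᵇ 0) ∧ (suc b ≡ᵇ m)) ∨ ((b ≡ᵇ 0) ∧ (suc a ≡ᵇ m))

IsHole : (G : Graph) (m : ℕ) → (Fin m → V G) → Set
IsHole G m h =
  4 ≤ m × Injective _≡_ _≡_ h
  × (∀ i j → adj G (h i) (h j) ≡ cycAdj m (toℕ i) (toℕ j))

nbrCount : (G : Graph) (c : V G) (m : ℕ) → (Fin m → V G) → ℕ
nbrCount G c m h = length (filterᵇ (λ i → adj G c (h i)) (allFin m))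

IsWheel : (G : Graph) (m : ℕ) → (Fin m → V G) → V G → Set
IsWheel G m h c = IsHole G m h × 3 ≤ nbrCount G c m h

IsEvenWheel : (G : Graph) (m : ℕ) → (Fin m → V G) → V G → Set
IsEvenWheel G m h c = IsWheel G m h c × Even (nbrCount G c m h)

EvenWheelFree : Graph → Set
EvenWheelFree G = ∀ m (h : Fin m → V G) (c : V G) → ¬ IsEvenWheel G m h c

EvenHoleFree : Graph → Set
EvenHoleFree G = ∀ m (h : Fin m → V G) → IsHole G m h → ¬ Even m

Bipartite : Graph → Set
Bipartite G = Σ[ col ∈ (V G → Bool) ] (∀ u v → T (adj G u v) → col u ≢ col v)

-- Base hole C = c_0 … c_{k-1} c_0 (k ≥ 4).  The centres are the l
-- consecutive vertices c_s, c_{s+1}, …, c_{s+l-1} (indices mod k), with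
-- 0 ≤ l ≤ k: l = 0 is the empty path, l < k a subpath of C, l = k all of C.
-- Petal number j (j < l) is a path p_{j,0} … p_{j,len j} (x = p_{j,0},
-- y = p_{j,len j}); its centre c = c_{s+j} is adjacent exactly to the
-- p_{j,t} with att j t = true; these are internal vertices (0 < t < len j),
-- there is at least one, and no two are consecutive on the path.

record DaisyData : Set where
  field
    k     : ℕ
    4≤k   : 4 ≤ k
    s     : Fin k
    l     : ℕ
    l≤k   : l ≤ k
    len   : Fin l → ℕ
    att   : (j : Fin l) → Fin (suc (len j)) → Bool
    att-internal : ∀ j t → T (att j t) → 0 < toℕ t × toℕ t < len j
    att-nonempty : ∀ j → ∃ λ t → T (att j t)
    att-sparse   : ∀ j t t' → T (att j t) → T (att j t') → suc (toℕ t) ≢ toℕ t'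

open DaisyData public

nonZero≤ : ∀ {k} → 4 ≤ k → NonZero k
nonZero≤ (s≤s _) = _

module _ (d : DaisyData) where
  private instance
    nzk : NonZero (k d)
    nzk = nonZero≤ (4≤k d)

  centre : Fin (l d) → Fin (k d)
  centre j = (toℕ (s d) + toℕ j) mod (k d)

  prevC : Fin (k d) → Fin (k d)
  prevC i = (toℕ i + (k d ∸ 1)) mod (k d)

  nextC : Fin (k d) → Fin (k d)
  nextC i = suc (toℕ i) mod (k d)

  DV : Set
  DV = Fin (k d) ⊎ Σ[ j ∈ Fin (l d) ] Fin (suc (len d j))

  private
    _==_ : ∀ {n} → Fin n → Fin n → Bool
    a == b = toℕ a ≡ᵇ toℕ b

    cpAdj : Fin (k d) → (j : Fin (l d)) → Fin (suc (len d j)) → Bool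
    cpAdj a j t =
      ((a == prevC (centre j)) ∧ (toℕ t ≡ᵇ 0))
      ∨ ((a == nextC (centre j)) ∧ (toℕ t ≡ᵇ len d j))
      ∨ ((a == centre j) ∧ att d j t)

  dAdj : DV → DV → Bool
  dAdj (inj₁ a) (inj₁ b) = cycAdj (k d) (toℕ a) (toℕ b)
  dAdj (inj₁ a) (inj₂ (j , t)) = cpAdj a j t
  dAdj (inj₂ (j , t)) (inj₁ a) = cpAdj a j t
  dAdj (inj₂ (j , t)) (inj₂ (j' , t')) =
    (j == j') ∧ ((suc (toℕ t) ≡ᵇ toℕ t') ∨ (suc (toℕ t') ≡ᵇ toℕ t))

  daisy : Graph
  daisy = record { V = DV ; adj = dAdj }

  centreV : Fin (l d) → DV
  centreV j = inj₁ (centre j)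

  petal : (j : Fin (l d)) → Fin (suc (len d j)) → DV
  petal j t = inj₂ (j , t)

  petalNbrs : Fin (l d) → ℕ
  petalNbrs j = nbrCount daisy (centreV j) (suc (len d j)) (petal j)

  -- the path R_j = c_{i-1} x_j P_j y_j c_{i+1} (i = centre j), indexed by
  -- 0 … len j + 2 (positions beyond len j + 2 are never used)
  R : (j : Fin (l d)) → ℕ → DV
  R j zero = inj₁ (prevC (centre j))
  R j (suc t) with t <? suc (len d j)
  ... | yes p = inj₂ (j , fromℕ< p)
  ... | no _  = inj₁ (nextC (centre j))

  IsExtSector : (j : Fin (l d)) → ℕ → ℕ → Set
  IsExtSector j a b =
    a < b × b ≤ len d j + 2
    × T (dAdj (centreV j) (R j a)) × T (dAdj (centreV j) (R j b))
    × (∀ u → a < u → u < b → dAdj (centreV j) (R j u) ≡ false)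

-- Let H be a hole of a daisy.  If H meets a centre c_j and a vertex of its
-- petal P_j, then H consists of c_j and one external sector of W_j.  Otherwise
-- H contains every petal it meets entirely and avoids its centre, so H is C
-- with some centres replaced by their petals, and its length is k plus the
-- lengths of those petals.  The sectors of W_j tile the path c_{j-1} P_j c_{j+1},
-- which ties the parity of len P_j to the parities of the sectors and of the
-- number of neighbours of c_j in P_j.  A vertex with an even number (at least
-- four) of neighbours on a hole must be a centre c_j off the hole with all of
-- P_j on it, and then it has 2 plus its number of neighbours in P_j.  For
-- bipartiteness the obstructions are an odd C, an odd sector of length at
-- least three (closed up by its centre) and a sector of length one (a
-- triangle); otherwise the parity of the position along C and along each
-- c_{j-1} P_j is a proper 2-colouring.

module Submission where

open import Defs
open import Data.Nat using (ℕ; _∸_)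
open import Data.Product using (_×_)
open import Function.Bundles using (_⇔_)

open import Data.Bool using (Bool; true; false; not; _∧_; _∨_; _xor_; T; T?; if_then_else_)
open import Data.Bool.Properties
  using ( not-involutive; not-distribˡ-xor; not-distribʳ-xor; not-¬; ¬-not; xor-comm; xor-identityʳ
        ; ∨-comm; ∨-identityʳ; ∨-zeroʳ; ∧-identityʳ; ∧-zeroʳ; T-≡; T-∨; T-∧ )
open import Data.Empty using (⊥; ⊥-elim)
open import Data.Fin using (Fin; toℕ; fromℕ; fromℕ<)
import Data.Fin as Fin
open import Data.Fin.Properties using (toℕ-fromℕ<; fromℕ<-toℕ; toℕ-fromℕ; toℕ-injective; toℕ<n; any?)
import Data.Fin.Properties as Fin
open import Data.List using (List; []; _∷_; _++_; length; filter; filterᵇ; map; allFin; tabulate; applyUpTo; deduplicate)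
open import Data.List.Properties
  using ( length-filter; length-deduplicate; map-tabulate; length-map; length-tabulate; length-++
        ; length-applyUpTo; filter-accept; filter-reject )
open import Data.List.Membership.Propositional using (_∈_)
open import Data.List.Membership.Propositional.Properties
  using ( ∈-filter⁺; ∈-filter⁻; ∈-deduplicate⁺; ∈-map⁺; ∈-map⁻; ∈-allFin; ∈-applyUpTo⁺; ∈-applyUpTo⁻
        ; ∈-++⁺ˡ; ∈-++⁺ʳ; ∈-++⁻ )
open import Data.List.Membership.Propositional.Properties.WithK using (unique∧set⇒bag)
open import Data.List.Membership.DecPropositional using () renaming (_∈?_ to ∈-dec)
open import Data.List.Relation.Binary.BagAndSetEquality using (∼bag⇒↭)
open import Data.List.Relation.Binary.Permutation.Propositional.Properties using (↭-length)
open import Data.List.Relation.Binary.Subset.Propositional using (_⊆_)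
open import Data.List.Relation.Unary.All as All using (All; []; _∷_)
open import Data.List.Relation.Unary.AllPairs using ([]; _∷_)
open import Data.List.Relation.Unary.Any using (here; there)
open import Data.List.Relation.Unary.Unique.Propositional using (Unique)
import Data.List.Relation.Unary.Unique.Propositional.Properties as Unique
open import Data.List.Relation.Unary.Unique.DecPropositional.Properties using (deduplicate-!)
open import Data.Nat using (zero; suc; pred; _+_; _*_; _/_; _%_; _≤_; _<_; _≤?_; _<?_; _≡ᵇ_; s≤s; s≤s⁻¹; z≤n; NonZero)
open import Data.Nat.DivMod
  using (_mod_; m≡m%n+[m/n]*n; %-distribˡ-+; m%n%n≡m%n; [m+n]%n≡m%n; m<n⇒m%n≡m; n%n≡0; m%n<n)
open import Data.Nat.Divisibility using (∣1⇒≡1; ∣m+n∣m⇒∣n; ∣m∣n⇒∣m+n; ∣-refl; _∣0)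
open import Data.Nat.Properties
open import Data.Product using (Σ; _,_; proj₁; proj₂)
import Data.Product.Properties as Product
open import Data.Sum using (_⊎_; inj₁; inj₂)
open import Data.Sum.Properties using (inj₁-injective)
import Data.Sum.Properties as Sum
open import Function.Bundles using (Equivalence; mk⇔)
open import Function.Definitions using (Injective)
open import Relation.Binary.Definitions using (DecidableEquality)
open import Relation.Binary.PropositionalEquality
open import Relation.Nullary using (¬_; Dec; yes; no; ¬?; _×-dec_)

T⇒≡true : ∀ {b} → T b → b ≡ true
T⇒≡true = Equivalence.to T-≡

≡true⇒T : ∀ {b} → b ≡ true → T b
≡true⇒T = Equivalence.from T-≡

bool-ext : ∀ {a b : Bool} → (a ≡ true → b ≡ true) → (b ≡ true → a ≡ true) → a ≡ b
bool-ext {false} {false} _ _ = refl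
bool-ext {false} {true}  _ g = g refl
bool-ext {true}  {false} f _ = sym (f refl)
bool-ext {true}  {true}  _ _ = refl

≡ᵇ-refl : ∀ n → (n ≡ᵇ n) ≡ true
≡ᵇ-refl n = T⇒≡true (≡⇒≡ᵇ n n refl)

≡ᵇ-true : ∀ {m n} → (m ≡ᵇ n) ≡ true → m ≡ n
≡ᵇ-true {m} {n} e = ≡ᵇ⇒≡ m n (≡true⇒T e)

≡ᵇ-false : ∀ {m n} → m ≢ n → (m ≡ᵇ n) ≡ false
≡ᵇ-false {m} {n} m≢n with m ≡ᵇ n in e
... | false = refl
... | true  = ⊥-elim (m≢n (≡ᵇ-true e))

≡⇒≡ᵇ-true : ∀ {m n} → m ≡ n → (m ≡ᵇ n) ≡ true
≡⇒≡ᵇ-true {m} refl = ≡ᵇ-refl m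

≡ᵇ-sym : ∀ m n → (m ≡ᵇ n) ≡ (n ≡ᵇ m)
≡ᵇ-sym m n = bool-ext (λ e → ≡⇒≡ᵇ-true (sym (≡ᵇ-true {m} e))) (λ e → ≡⇒≡ᵇ-true (sym (≡ᵇ-true {n} e)))

≡ᵇ-+ : ∀ a m n → (a + m ≡ᵇ a + n) ≡ (m ≡ᵇ n)
≡ᵇ-+ zero    m n = refl
≡ᵇ-+ (suc a) m n = ≡ᵇ-+ a m n

parity : ℕ → Bool
parity zero    = false
parity (suc n) = not (parity n)

parity-+ : ∀ m n → parity (m + n) ≡ parity m xor parity n
parity-+ zero    n = refl
parity-+ (suc m) n = trans (cong not (parity-+ m n)) (not-distribˡ-xor (parity m) (parity n))

parity-∸ : ∀ {m n} → m ≤ n → parity n ≡ parity m xor parity (n ∸ m)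
parity-∸ {m} m≤n = trans (cong parity (sym (m+[n∸m]≡n m≤n))) (parity-+ m _)

even⇒parity≡false : ∀ n → Even n → parity n ≡ false
even⇒parity≡false zero          _  = refl
even⇒parity≡false (suc zero)    2∣1 with () ← ∣1⇒≡1 2∣1
even⇒parity≡false (suc (suc n)) 2∣n+2 =
  trans (not-involutive _) (even⇒parity≡false n (∣m+n∣m⇒∣n 2∣n+2 ∣-refl))

parity≡false⇒even : ∀ n → parity n ≡ false → Even n
parity≡false⇒even zero          _ = 2 ∣0
parity≡false⇒even (suc (suc n)) e =
  ∣m∣n⇒∣m+n ∣-refl (parity≡false⇒even n (trans (sym (not-involutive _)) e))

odd⇒parity≡true : ∀ n → Odd n → parity n ≡ true
odd⇒parity≡true n odd with parity n in e
... | true  = refl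
... | false = ⊥-elim (odd (parity≡false⇒even n e))

parity≡true⇒odd : ∀ n → parity n ≡ true → Odd n
parity≡true⇒odd n e even with () ← trans (sym e) (even⇒parity≡false n even)

parity-%-even : ∀ x n .{{_ : NonZero n}} → Even n → parity (x % n) ≡ parity x
parity-%-even x n even-n = begin
  parity (x % n)                            ≡⟨ xor-identityʳ (parity (x % n)) ⟨
  parity (x % n) xor false                  ≡⟨ cong (parity (x % n) xor_) (parity-multiple (x / n)) ⟨
  parity (x % n) xor parity ((x / n) * n)   ≡⟨ parity-+ (x % n) _ ⟨
  parity (x % n + (x / n) * n)              ≡⟨ cong parity (m≡m%n+[m/n]*n x n) ⟨
  parity x                                  ∎
  where
    open ≡-Reasoning
    parity-multiple : ∀ q → parity (q * n) ≡ false
    parity-multiple zero    = refl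
    parity-multiple (suc q) = trans (parity-+ n (q * n))
                                (cong₂ _xor_ (even⇒parity≡false n even-n) (parity-multiple q))

module _ {A : Set} where

  unique-⊆-⊇⇒length-≡ : {xs ys : List A} → Unique xs → Unique ys →
                        xs ⊆ ys → ys ⊆ xs → length xs ≡ length ys
  unique-⊆-⊇⇒length-≡ ux uy xs⊆ys ys⊆xs =
    ↭-length (∼bag⇒↭ (unique∧set⇒bag ux uy (mk⇔ xs⊆ys ys⊆xs)))

  unique-⊆⇒length-≤ : DecidableEquality A → {xs ys : List A} → Unique xs →
                      xs ⊆ ys → length xs ≤ length ys
  unique-⊆⇒length-≤ _≟_ {xs} {ys} ux xs⊆ys = begin
    length xs                            ≡⟨ unique-⊆-⊇⇒length-≡ ux (Unique.filter⁺ ∈xs? (deduplicate-! _≟_ ys))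
                                              (λ v∈ → ∈-filter⁺ ∈xs? (∈-deduplicate⁺ _≟_ (xs⊆ys v∈)) v∈)
                                              (λ v∈ → proj₂ (∈-filter⁻ ∈xs? {xs = deduplicate _≟_ ys} v∈)) ⟩
    length (filter ∈xs? (deduplicate _≟_ ys)) ≤⟨ length-filter ∈xs? (deduplicate _≟_ ys) ⟩
    length (deduplicate _≟_ ys)          ≤⟨ length-deduplicate _≟_ ys ⟩
    length ys                            ∎
    where
      open ≤-Reasoning
      ∈xs? : ∀ v → Dec (v ∈ xs)
      ∈xs? v = ∈-dec _≟_ v xs

  length-filter+length-filter-∁ : ∀ {P : A → Set} (P? : ∀ x → Dec (P x)) (xs : List A) →
    length (filter P? xs) + length (filter (λ x → ¬? (P? x)) xs) ≡ length xs
  length-filter+length-filter-∁ P? []       = refl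
  length-filter+length-filter-∁ P? (x ∷ xs) with P? x
  ... | yes _ = cong suc (length-filter+length-filter-∁ P? xs)
  ... | no  _ = trans (+-suc _ _) (cong suc (length-filter+length-filter-∁ P? xs))

∨-swap : ∀ a b c d → (a ∨ b ∨ c ∨ d) ≡ (b ∨ a ∨ d ∨ c)
∨-swap true  true  c d = refl
∨-swap true  false c d = refl
∨-swap false true  c d = refl
∨-swap false false c d = ∨-comm c d

cycAdj-sym : ∀ n x y → cycAdj n x y ≡ cycAdj n y x
cycAdj-sym n x y = ∨-swap (suc x ≡ᵇ y) (suc y ≡ᵇ x) ((x ≡ᵇ 0) ∧ (suc y ≡ᵇ n)) ((y ≡ᵇ 0) ∧ (suc x ≡ᵇ n))

cycAdj-0-0 : ∀ {n} → 2 ≤ n → cycAdj n 0 0 ≡ false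
cycAdj-0-0 (s≤s (s≤s _)) = refl

cycAdj-last-1 : ∀ {n} → 4 ≤ n → cycAdj n (n ∸ 1) 1 ≡ false
cycAdj-last-1 (s≤s (s≤s (s≤s (s≤s _)))) = refl

cycAdj-interior : ∀ {n x y} → suc x < n → suc y < n → cycAdj n x y ≡ ((suc x ≡ᵇ y) ∨ (suc y ≡ᵇ x))
cycAdj-interior {n} {x} {y} 1+x<n 1+y<n
  rewrite ≡ᵇ-false (<⇒≢ 1+x<n) | ≡ᵇ-false (<⇒≢ 1+y<n) | ∧-zeroʳ (x ≡ᵇ 0) | ∧-zeroʳ (y ≡ᵇ 0)
        | ∨-identityʳ (suc y ≡ᵇ x) = refl

module Cyclic (n : ℕ) .{{_ : NonZero n}} where

  shift : ℕ → ℕ → ℕ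
  shift c r = (c + r) % n

  shift<n : ∀ c r → shift c r < n
  shift<n c r = m%n<n (c + r) n

  shift-%ˡ : ∀ c r → shift (c % n) r ≡ shift c r
  shift-%ˡ c r = begin
    (c % n + r) % n         ≡⟨ %-distribˡ-+ (c % n) r n ⟩
    (c % n % n + r % n) % n ≡⟨ cong (λ x → (x + r % n) % n) (m%n%n≡m%n c n) ⟩
    (c % n + r % n) % n     ≡⟨ %-distribˡ-+ c r n ⟨
    (c + r) % n             ∎
    where open ≡-Reasoning

  shift-shift : ∀ c r r' → shift (shift c r) r' ≡ shift c (r + r')
  shift-shift c r r' = trans (shift-%ˡ (c + r) r') (cong (_% n) (+-assoc c r r'))

  shift-+n : ∀ c r → shift c (r + n) ≡ shift c r
  shift-+n c r = trans (cong (_% n) (sym (+-assoc c r n))) ([m+n]%n≡m%n (c + r) n)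

  shift-0 : ∀ {c} → c < n → shift c 0 ≡ c
  shift-0 {c} c<n = trans (cong (_% n) (+-identityʳ c)) (m<n⇒m%n≡m c<n)

  shift-1 : ∀ c → shift c 1 ≡ suc c % n
  shift-1 c = cong (_% n) (+-comm c 1)

  shift-cancel : ∀ {c r s} → c < n → r + s ≡ n → shift (shift c r) s ≡ c
  shift-cancel {c} {r} {s} c<n r+s≡n = begin
    shift (shift c r) s ≡⟨ shift-shift c r s ⟩
    shift c (r + s)     ≡⟨ cong (shift c) r+s≡n ⟩
    shift c (0 + n)     ≡⟨ shift-+n c 0 ⟩
    shift c 0           ≡⟨ shift-0 c<n ⟩
    c                   ∎
    where open ≡-Reasoning

  unshift : ∀ {ρ} a → ρ ≤ n → shift (shift ρ a) (n ∸ ρ) ≡ a % n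
  unshift {ρ} a ρ≤n = trans (shift-shift ρ a (n ∸ ρ)) (trans (cong (_% n) ρ+[a+[n∸ρ]]≡a+n) ([m+n]%n≡m%n a n))
    where
      ρ+[a+[n∸ρ]]≡a+n : ρ + (a + (n ∸ ρ)) ≡ a + n
      ρ+[a+[n∸ρ]]≡a+n = trans (+-comm ρ _) (trans (+-assoc a (n ∸ ρ) ρ) (cong (a +_) (m∸n+n≡m ρ≤n)))

  private
    suc≡⇒shift : ∀ {a b} → suc a ≡ b → b < n → b ≡ shift a 1
    suc≡⇒shift {a} refl b<n = sym (trans (shift-1 a) (m<n⇒m%n≡m b<n))

    wrap⇒shift : ∀ {a b} → a ≡ 0 → suc b ≡ n → a ≡ shift b 1
    wrap⇒shift {b = b} refl sb≡n = sym (trans (shift-1 b) (trans (cong (_% n) sb≡n) (n%n≡0 n)))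

  shift-injective : ∀ c {a b} → a < n → b < n → shift c a ≡ shift c b → a ≡ b
  shift-injective c {a} {b} a<n b<n e = begin
    a                         ≡⟨ m<n⇒m%n≡m a<n ⟨
    a % n                     ≡⟨ unshift a ρ≤n ⟨
    shift (shift ρ a) (n ∸ ρ) ≡⟨ cong (λ x → shift x (n ∸ ρ)) (trans (shift-%ˡ c a) (trans e (sym (shift-%ˡ c b)))) ⟩
    shift (shift ρ b) (n ∸ ρ) ≡⟨ unshift b ρ≤n ⟩
    b % n                     ≡⟨ m<n⇒m%n≡m b<n ⟩
    b                         ∎
    where
      open ≡-Reasoning
      ρ : ℕ
      ρ = c % n
      ρ≤n : ρ ≤ n
      ρ≤n = <⇒≤ (m%n<n c n)

  cycAdj⇒shift : ∀ {x y} → x < n → y < n → cycAdj n x y ≡ true → y ≡ shift x 1 ⊎ x ≡ shift y 1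
  cycAdj⇒shift {x} {y} x<n y<n e with Equivalence.to T-∨ (≡true⇒T e)
  ... | inj₁ sx≡y = inj₁ (suc≡⇒shift (≡ᵇ⇒≡ _ _ sx≡y) y<n)
  ... | inj₂ e₂ with Equivalence.to T-∨ e₂
  ... | inj₁ sy≡x = inj₂ (suc≡⇒shift (≡ᵇ⇒≡ _ _ sy≡x) x<n)
  ... | inj₂ e₃ with Equivalence.to T-∨ e₃
  ... | inj₁ e₄ = let x≡0 , sy≡n = Equivalence.to T-∧ e₄ in inj₂ (wrap⇒shift (≡ᵇ⇒≡ x 0 x≡0) (≡ᵇ⇒≡ _ n sy≡n))
  ... | inj₂ e₄ = let y≡0 , sx≡n = Equivalence.to T-∧ e₄ in inj₁ (wrap⇒shift (≡ᵇ⇒≡ y 0 y≡0) (≡ᵇ⇒≡ _ n sx≡n))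

  shift⇒cycAdj : ∀ {x y} → x < n → y ≡ shift x 1 → cycAdj n x y ≡ true
  shift⇒cycAdj {x} x<n refl with m≤n⇒m<n∨m≡n x<n
  ... | inj₁ sx<n = subst (λ y → cycAdj n x y ≡ true) (suc≡⇒shift refl sx<n)
                      (T⇒≡true (Equivalence.from T-∨ (inj₁ (≡⇒≡ᵇ (suc x) (suc x) refl))))
  ... | inj₂ sx≡n = subst (λ y → cycAdj n x y ≡ true) (wrap⇒shift refl sx≡n)
                      (T⇒≡true (Equivalence.from (T-∨ {suc x ≡ᵇ 0}) (inj₂ (Equivalence.from (T-∨ {1 ≡ᵇ x}) (inj₂
                        (Equivalence.from (T-∨ {(x ≡ᵇ 0) ∧ (1 ≡ᵇ n)}) (inj₂ (≡⇒≡ᵇ (suc x) n sx≡n))))))))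

  shiftᵇ : ∀ c {r₁ r₂} → r₁ < n → r₂ < n → (shift c r₁ ≡ᵇ shift c r₂) ≡ (r₁ ≡ᵇ r₂)
  shiftᵇ c {r₁} {r₂} r₁<n r₂<n =
    bool-ext (λ e → ≡⇒≡ᵇ-true (shift-injective c r₁<n r₂<n (≡ᵇ-true e)))
             (λ e → ≡⇒≡ᵇ-true (cong (shift c) (≡ᵇ-true {r₁} e)))

  shift-%ʳ : ∀ c r → shift c (r % n) ≡ shift c r
  shift-%ʳ c r = begin
    (c + r % n) % n ≡⟨ cong (_% n) (+-comm c (r % n)) ⟩
    (r % n + c) % n ≡⟨ shift-%ˡ r c ⟩
    (r + c) % n     ≡⟨ cong (_% n) (+-comm r c) ⟩
    (c + r) % n     ∎
    where open ≡-Reasoning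

  shift-step : ∀ c x → shift c (shift x 1) ≡ shift (shift c x) 1
  shift-step c x = trans (shift-%ʳ c (x + 1)) (sym (shift-shift c x 1))

  cycAdj-shift : ∀ c {x y} → x < n → y < n → cycAdj n (shift c x) (shift c y) ≡ cycAdj n x y
  cycAdj-shift c {x} {y} x<n y<n = bool-ext to from
    where
      to : cycAdj n (shift c x) (shift c y) ≡ true → cycAdj n x y ≡ true
      to e with cycAdj⇒shift (shift<n c x) (shift<n c y) e
      ... | inj₁ y≡ = shift⇒cycAdj x<n
                        (shift-injective c y<n (shift<n x 1) (trans y≡ (sym (shift-step c x))))
      ... | inj₂ x≡ = trans (cycAdj-sym n x y) (shift⇒cycAdj y<n
                        (shift-injective c x<n (shift<n y 1) (trans x≡ (sym (shift-step c y)))))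
      from : cycAdj n x y ≡ true → cycAdj n (shift c x) (shift c y) ≡ true
      from e with cycAdj⇒shift x<n y<n e
      ... | inj₁ refl = shift⇒cycAdj (shift<n c x) (shift-step c x)
      ... | inj₂ refl = trans (cycAdj-sym n (shift c (shift y 1)) (shift c y))
                          (shift⇒cycAdj (shift<n c y) (shift-step c y))

-- Gaps between consecutive trues of a Boolean sequence

indicator : Bool → ℕ
indicator b = if b then 1 else 0

countTrue : (ℕ → Bool) → ℕ → ℕ
countTrue g zero    = 0
countTrue g (suc n) = indicator (g 0) + countTrue (λ u → g (suc u)) n

countTrue-suc : ∀ g n → countTrue g (suc n) ≡ indicator (g n) + countTrue g n
countTrue-suc g zero    = refl
countTrue-suc g (suc n) = begin
  indicator (g 0) + countTrue g′ (suc n)           ≡⟨ cong (indicator (g 0) +_) (countTrue-suc g′ n) ⟩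
  indicator (g 0) + (indicator (g′ n) + countTrue g′ n) ≡⟨ +-comm (indicator (g 0)) _ ⟩
  (indicator (g′ n) + countTrue g′ n) + indicator (g 0) ≡⟨ +-assoc (indicator (g′ n)) _ _ ⟩
  indicator (g′ n) + (countTrue g′ n + indicator (g 0)) ≡⟨ cong (indicator (g′ n) +_) (+-comm _ (indicator (g 0))) ⟩
  indicator (g′ n) + countTrue g (suc n)           ∎
  where
    open ≡-Reasoning
    g′ : ℕ → Bool
    g′ u = g (suc u)

length-filterᵇ-map : ∀ {A B : Set} (p : B → Bool) (f : A → B) (xs : List A) →
  length (filterᵇ (λ x → p (f x)) xs) ≡ length (filterᵇ p (map f xs))
length-filterᵇ-map p f []       = refl
length-filterᵇ-map p f (x ∷ xs) with p (f x)
... | true  = cong suc (length-filterᵇ-map p f xs)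
... | false = length-filterᵇ-map p f xs

countTrue-positive : ∀ g {u n} → u < n → g u ≡ true → 1 ≤ countTrue g n
countTrue-positive g {u} {suc n} u<1+n gu rewrite countTrue-suc g n with m≤n⇒m<n∨m≡n (s≤s⁻¹ u<1+n)
... | inj₁ u<n  = ≤-trans (countTrue-positive g u<n gu) (m≤n+m _ _)
... | inj₂ refl rewrite gu = s≤s z≤n

private
  length-filterᵇ-allFin-suc : ∀ n (f : Fin (suc n) → Bool) →
    length (filterᵇ f (tabulate Fin.suc)) ≡ length (filterᵇ (λ t → f (Fin.suc t)) (allFin n))
  length-filterᵇ-allFin-suc n f =
    trans (cong (λ xs → length (filterᵇ f xs)) (sym (map-tabulate (λ i → i) Fin.suc)))
          (sym (length-filterᵇ-map f Fin.suc (allFin n)))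

  length-filterᵇ-allFin-∷ : ∀ n (f : Fin (suc n) → Bool) →
    length (filterᵇ f (allFin (suc n))) ≡ indicator (f Fin.zero) + length (filterᵇ (λ t → f (Fin.suc t)) (allFin n))
  length-filterᵇ-allFin-∷ n f with f Fin.zero
  ... | true  = cong suc (length-filterᵇ-allFin-suc n f)
  ... | false = length-filterᵇ-allFin-suc n f

length-filterᵇ-allFin : ∀ n (f : Fin n → Bool) (g : ℕ → Bool) → (∀ t → f t ≡ g (toℕ t)) →
                        length (filterᵇ f (allFin n)) ≡ countTrue g n
length-filterᵇ-allFin zero    f g f≡g = refl
length-filterᵇ-allFin (suc n) f g f≡g = begin
  length (filterᵇ f (allFin (suc n)))
    ≡⟨ length-filterᵇ-allFin-∷ n f ⟩
  indicator (f Fin.zero) + length (filterᵇ (λ t → f (Fin.suc t)) (allFin n))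
    ≡⟨ cong₂ _+_ (cong indicator (f≡g Fin.zero)) (length-filterᵇ-allFin n _ _ (λ t → f≡g (Fin.suc t))) ⟩
  indicator (g 0) + countTrue (λ u → g (suc u)) n
    ∎
  where open ≡-Reasoning

module Gaps (g : ℕ → Bool) (g0 : g 0 ≡ true) where

  IsGap : ℕ → ℕ → Set
  IsGap a b = a < b × T (g a) × T (g b) × (∀ u → a < u → u < b → g u ≡ false)

  -- the number of u with 0 < u ≤ n and g u
  count : ℕ → ℕ
  count = countTrue (λ u → g (suc u))

  lastTrue : ℕ → ℕ
  lastTrue zero    = 0
  lastTrue (suc u) = if g (suc u) then suc u else lastTrue u

  lastTrue-≤ : ∀ u → lastTrue u ≤ u
  lastTrue-≤ zero = z≤n
  lastTrue-≤ (suc u) with g (suc u)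
  ... | true  = ≤-refl
  ... | false = m≤n⇒m≤1+n (lastTrue-≤ u)

  lastTrue-true : ∀ u → g (lastTrue u) ≡ true
  lastTrue-true zero = g0
  lastTrue-true (suc u) with g (suc u) in e
  ... | true  = e
  ... | false = lastTrue-true u

  lastTrue-after : ∀ u {z} → lastTrue u < z → z ≤ u → g z ≡ false
  lastTrue-after zero    lt z≤0 = ⊥-elim (≤⇒≯ z≤0 lt)
  lastTrue-after (suc u) lt z≤ with g (suc u) in e
  ... | true  = ⊥-elim (≤⇒≯ z≤ lt)
  ... | false with m≤n⇒m<n∨m≡n z≤
  ...   | inj₁ z<1+u = lastTrue-after u lt (s≤s⁻¹ z<1+u)
  ...   | inj₂ refl  = e

  lastTrue-self : ∀ {u} → g u ≡ true → lastTrue u ≡ u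
  lastTrue-self {zero}  _ = refl
  lastTrue-self {suc u} e rewrite e = refl

  count-lastTrue : ∀ u → count (lastTrue u) ≡ count u
  count-lastTrue zero = refl
  count-lastTrue (suc u) with g (suc u) in e
  ... | true  = refl
  ... | false = trans (count-lastTrue u)
                  (sym (trans (countTrue-suc (λ v → g (suc v)) u) (cong (λ b → indicator b + count u) e)))

  gap-ending-at : ∀ u → g (suc u) ≡ true → IsGap (lastTrue u) (suc u)
  gap-ending-at u e = s≤s (lastTrue-≤ u) , ≡true⇒T (lastTrue-true u) , ≡true⇒T e
                    , λ z lt z<1+u → lastTrue-after u lt (s≤s⁻¹ z<1+u)

  module _ {N} (odd-gaps : ∀ a b → b ≤ N → IsGap a b → Odd (b ∸ a)) where

    private
      parity-lastTrue : ∀ u → u ≤ N → parity (lastTrue u) ≡ parity (count (lastTrue u))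
      parity-lastTrue zero _ = refl
      parity-lastTrue (suc u) 1+u≤N with g (suc u) in e
      ... | false = parity-lastTrue u (<⇒≤ 1+u≤N)
      ... | true  = begin
        parity (suc u)                ≡⟨ parity-∸ (m≤n⇒m≤1+n (lastTrue-≤ u)) ⟩
        parity ℓ xor parity (suc u ∸ ℓ) ≡⟨ cong (parity ℓ xor_) (odd⇒parity≡true _ (odd-gaps ℓ (suc u) 1+u≤N (gap-ending-at u e))) ⟩
        parity ℓ xor true             ≡⟨ xor-comm (parity ℓ) true ⟩
        not (parity ℓ)                ≡⟨ cong not (parity-lastTrue u (<⇒≤ 1+u≤N)) ⟩
        not (parity (count ℓ))        ≡⟨ cong (λ c → not (parity c)) (count-lastTrue u) ⟩
        not (parity (count u))        ≡⟨ cong (λ b → parity (indicator b + count u)) e ⟨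
        parity (indicator (g (suc u)) + count u) ≡⟨ cong parity (countTrue-suc (λ v → g (suc v)) u) ⟨
        parity (count (suc u))        ∎
        where
          open ≡-Reasoning
          ℓ : ℕ
          ℓ = lastTrue u

    odd-gaps⇒parity : ∀ {u} → u ≤ N → g u ≡ true → parity u ≡ parity (count u)
    odd-gaps⇒parity {u} u≤N e =
      subst (λ v → parity v ≡ parity (count v)) (lastTrue-self e) (parity-lastTrue u u≤N)

  module _ {N} (even-gaps : ∀ a b → b ≤ N → IsGap a b → Even (b ∸ a)) where

    private
      parity-lastTrue : ∀ u → u ≤ N → parity (lastTrue u) ≡ false
      parity-lastTrue zero _ = refl
      parity-lastTrue (suc u) 1+u≤N with g (suc u) in e
      ... | false = parity-lastTrue u (<⇒≤ 1+u≤N)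
      ... | true  = begin
        parity (suc u)                  ≡⟨ parity-∸ (m≤n⇒m≤1+n (lastTrue-≤ u)) ⟩
        parity ℓ xor parity (suc u ∸ ℓ) ≡⟨ cong₂ _xor_ (parity-lastTrue u (<⇒≤ 1+u≤N))
                                             (even⇒parity≡false _ (even-gaps ℓ (suc u) 1+u≤N (gap-ending-at u e))) ⟩
        false                           ∎
        where
          open ≡-Reasoning
          ℓ : ℕ
          ℓ = lastTrue u

    even-gaps⇒parity : ∀ {u} → u ≤ N → g u ≡ true → parity u ≡ false
    even-gaps⇒parity {u} u≤N e = subst (λ v → parity v ≡ false) (lastTrue-self e) (parity-lastTrue u u≤N)

  private
    firstTrue : ∀ n u → g (u + n) ≡ true →
                Σ ℕ λ b → u ≤ b × b ≤ u + n × g b ≡ true × (∀ z → u ≤ z → z < b → g z ≡ false)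
    firstTrue n u e with g u in gu
    ... | true = u , ≤-refl , m≤m+n u n , gu , λ z u≤z z<u → ⊥-elim (<⇒≱ z<u u≤z)
    firstTrue zero u e | false with () ← trans (sym gu) (trans (cong g (sym (+-identityʳ u))) e)
    firstTrue (suc n) u e | false with firstTrue n (suc u) (trans (cong g (sym (+-suc u n))) e)
    ... | b , 1+u≤b , b≤ , gb , before-b =
      b , <⇒≤ 1+u≤b , ≤-trans b≤ (≤-reflexive (sym (+-suc u n))) , gb , before-b′
      where
        before-b′ : ∀ z → u ≤ z → z < b → g z ≡ false
        before-b′ z u≤z z<b with m≤n⇒m<n∨m≡n u≤z
        ... | inj₁ u<z = before-b z u<z z<b
        ... | inj₂ refl = gu

  gap-around : ∀ {N u} → g N ≡ true → u ≤ N → g u ≡ false →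
               Σ ℕ λ a → Σ ℕ λ b → IsGap a b × a < u × u < b × b ≤ N
  gap-around {N} {u} gN u≤N gu with firstTrue (N ∸ u) u (trans (cong g (m+[n∸m]≡n u≤N)) gN)
  ... | b , u≤b , b≤ , gb , before-b = lastTrue u , b , (<-trans a<u u<b , ≡true⇒T (lastTrue-true u) , ≡true⇒T gb , inside) , a<u , u<b
                                      , ≤-trans b≤ (≤-reflexive (m+[n∸m]≡n u≤N))
    where
      differ : ∀ {v} → g v ≡ true → v ≢ u
      differ gv refl with () ← trans (sym gv) gu
      a<u : lastTrue u < u
      a<u = ≤∧≢⇒< (lastTrue-≤ u) (differ (lastTrue-true u))
      u<b : u < b
      u<b = ≤∧≢⇒< u≤b (λ e → differ gb (sym e))
      inside : ∀ z → lastTrue u < z → z < b → g z ≡ false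
      inside z a<z z<b with z ≤? u
      ... | yes z≤u = lastTrue-after u a<z z≤u
      ... | no  z≰u = before-b z (<⇒≤ (≰⇒> z≰u)) z<b

module _ (P : ℕ → Set) {a b : ℕ}
         (step : ∀ v → a < v → v < b → P v → P (pred v) × P (suc v))
         {u : ℕ} (a<u : a < u) (u<b : u < b) (Pu : P u) where

  private
    down : ∀ k v → v + k ≡ u → a ≤ v → P v
    down zero    v v+0≡u _   = subst P (trans (sym v+0≡u) (+-identityʳ v)) Pu
    down (suc k) v v+k+1≡u a≤v =
      proj₁ (step (suc v) (s≤s a≤v) (≤-<-trans 1+v≤u u<b)
                  (down k (suc v) (trans (sym (+-suc v k)) v+k+1≡u) (m≤n⇒m≤1+n a≤v)))
      where
        1+v≤u : suc v ≤ u
        1+v≤u = ≤-trans (s≤s (m≤m+n v k)) (≤-reflexive (trans (sym (+-suc v k)) v+k+1≡u))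

    up : ∀ k → u + k ≤ b → P (u + k)
    up zero    _        = subst P (sym (+-identityʳ u)) Pu
    up (suc k) u+k+1≤b =
      subst P (sym (+-suc u k))
        (proj₂ (step (u + k) (<-≤-trans a<u (m≤m+n u k)) (subst (_≤ b) (+-suc u k) u+k+1≤b)
                     (up k (≤-trans (+-monoʳ-≤ u (n≤1+n k)) u+k+1≤b))))

  spread : ∀ {v} → a ≤ v → v ≤ b → P v
  spread {v} a≤v v≤b with v ≤? u
  ... | yes v≤u = down (u ∸ v) v (trans (+-comm v (u ∸ v)) (m∸n+n≡m v≤u)) a≤v
  ... | no  v≰u = subst P (m+[n∸m]≡n u≤v) (up (v ∸ u) (≤-trans (≤-reflexive (m+[n∸m]≡n u≤v)) v≤b))
    where
      u≤v : u ≤ v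
      u≤v = <⇒≤ (≰⇒> v≰u)

module Hole {G : Graph} {m : ℕ} {h : Fin m → V G} (H : IsHole G m h) where

  4≤m : 4 ≤ m
  4≤m = proj₁ H

  h-injective : Injective _≡_ _≡_ h
  h-injective = proj₁ (proj₂ H)

  h-adj : ∀ i j → adj G (h i) (h j) ≡ cycAdj m (toℕ i) (toℕ j)
  h-adj = proj₂ (proj₂ H)

  instance
    m-nonZero : NonZero m
    m-nonZero = nonZero≤ 4≤m

  open Cyclic m

  OnHole : V G → Set
  OnHole v = Σ (Fin m) λ i → h i ≡ v

  next prev : Fin m → Fin m
  next i = suc (toℕ i) mod m
  prev i = (toℕ i + (m ∸ 1)) mod m

  toℕ-next : ∀ i → toℕ (next i) ≡ shift (toℕ i) 1
  toℕ-next i = trans (toℕ-fromℕ< _) (sym (shift-1 (toℕ i)))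

  toℕ-prev : ∀ i → toℕ (prev i) ≡ shift (toℕ i) (m ∸ 1)
  toℕ-prev i = toℕ-fromℕ< _

  1<m : 1 < m
  1<m = ≤-trans (s≤s (s≤s z≤n)) 4≤m

  private
    m∸1+1≡m : m ∸ 1 + 1 ≡ m
    m∸1+1≡m = m∸n+n≡m (≤-trans (s≤s z≤n) 4≤m)


  m∸1<m : m ∸ 1 < m
  m∸1<m = subst (m ∸ 1 <_) m∸1+1≡m (m<m+n (m ∸ 1) (s≤s z≤n))

  toℕ-self : ∀ i → toℕ i ≡ shift (toℕ i) 0
  toℕ-self i = sym (shift-0 (toℕ<n i))

  next-prev : ∀ i → next (prev i) ≡ i
  next-prev i = toℕ-injective (trans (toℕ-next (prev i))
                  (trans (cong (λ x → shift x 1) (toℕ-prev i)) (shift-cancel (toℕ<n i) m∸1+1≡m)))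

  prev-next : ∀ i → prev (next i) ≡ i
  prev-next i = toℕ-injective (trans (toℕ-prev (next i))
                  (trans (cong (λ x → shift x (m ∸ 1)) (toℕ-next i))
                         (shift-cancel (toℕ<n i) (trans (+-comm 1 (m ∸ 1)) m∸1+1≡m))))

  adj-next : ∀ i → adj G (h i) (h (next i)) ≡ true
  adj-next i = trans (h-adj i (next i)) (shift⇒cycAdj (toℕ<n i) (toℕ-next i))

  adj-prev : ∀ i → adj G (h i) (h (prev i)) ≡ true
  adj-prev i = trans (h-adj i (prev i)) (trans (cycAdj-sym m (toℕ i) (toℕ (prev i)))
                 (shift⇒cycAdj (toℕ<n (prev i)) (trans (cong toℕ (sym (next-prev i))) (toℕ-next (prev i)))))

  adj-self : ∀ i → adj G (h i) (h i) ≡ false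
  adj-self i = begin
    adj G (h i) (h i)                               ≡⟨ h-adj i i ⟩
    cycAdj m (toℕ i) (toℕ i)                        ≡⟨ cong₂ (cycAdj m) (toℕ-self i) (toℕ-self i) ⟩
    cycAdj m (shift (toℕ i) 0) (shift (toℕ i) 0)    ≡⟨ cycAdj-shift (toℕ i) 0<m 0<m ⟩
    cycAdj m 0 0                                    ≡⟨ cycAdj-0-0 1<m ⟩
    false                                           ∎
    where
      open ≡-Reasoning
      0<m : 0 < m
      0<m = <-trans (s≤s z≤n) 1<m

  adj-prev-next : ∀ i → adj G (h (prev i)) (h (next i)) ≡ false
  adj-prev-next i = begin
    adj G (h (prev i)) (h (next i))                       ≡⟨ h-adj (prev i) (next i) ⟩
    cycAdj m (toℕ (prev i)) (toℕ (next i))                ≡⟨ cong₂ (cycAdj m) (toℕ-prev i) (toℕ-next i) ⟩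
    cycAdj m (shift (toℕ i) (m ∸ 1)) (shift (toℕ i) 1)    ≡⟨ cycAdj-shift (toℕ i) m∸1<m 1<m ⟩
    cycAdj m (m ∸ 1) 1                                    ≡⟨ cycAdj-last-1 4≤m ⟩
    false                                                 ∎
    where open ≡-Reasoning

  adjacent⇒≢ : ∀ {i j} → adj G (h i) (h j) ≡ true → i ≢ j
  adjacent⇒≢ {i} e refl with () ← trans (sym e) (adj-self i)

  next≢prev : ∀ i → next i ≢ prev i
  next≢prev i e = 1≢m∸1 4≤m (shift-injective (toℕ i) 1<m m∸1<m
                    (trans (sym (toℕ-next i)) (trans (cong toℕ e) (toℕ-prev i))))
    where
      1≢m∸1 : ∀ {n} → 4 ≤ n → 1 ≢ n ∸ 1
      1≢m∸1 (s≤s (s≤s (s≤s (s≤s _)))) ()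

  adj⇒next⊎prev : ∀ i j → adj G (h i) (h j) ≡ true → j ≡ next i ⊎ j ≡ prev i
  adj⇒next⊎prev i j e with cycAdj⇒shift (toℕ<n i) (toℕ<n j) (trans (sym (h-adj i j)) e)
  ... | inj₁ j≡ = inj₁ (toℕ-injective (trans j≡ (sym (toℕ-next i))))
  ... | inj₂ i≡ = inj₂ (trans (sym (prev-next j)) (cong prev (toℕ-injective (trans (toℕ-next j) (sym i≡)))))

  iterate : Fin m → ℕ → Fin m
  iterate i zero    = i
  iterate i (suc r) = next (iterate i r)

  toℕ-iterate : ∀ i r → toℕ (iterate i r) ≡ shift (toℕ i) r
  toℕ-iterate i zero    = toℕ-self i
  toℕ-iterate i (suc r) = begin
    toℕ (next (iterate i r))    ≡⟨ toℕ-next (iterate i r) ⟩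
    shift (toℕ (iterate i r)) 1 ≡⟨ cong (λ x → shift x 1) (toℕ-iterate i r) ⟩
    shift (shift (toℕ i) r) 1   ≡⟨ shift-shift (toℕ i) r 1 ⟩
    shift (toℕ i) (r + 1)       ≡⟨ cong (shift (toℕ i)) (+-comm r 1) ⟩
    shift (toℕ i) (suc r)       ∎
    where open ≡-Reasoning

  iterate-reaches : ∀ i j → iterate i (toℕ j + (m ∸ toℕ i)) ≡ j
  iterate-reaches i j = toℕ-injective (begin
    toℕ (iterate i (toℕ j + (m ∸ toℕ i)))       ≡⟨ toℕ-iterate i _ ⟩
    shift (toℕ i) (toℕ j + (m ∸ toℕ i))         ≡⟨ shift-shift (toℕ i) (toℕ j) _ ⟨
    shift (shift (toℕ i) (toℕ j)) (m ∸ toℕ i)   ≡⟨ unshift (toℕ j) (<⇒≤ (toℕ<n i)) ⟩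
    toℕ j % m                                   ≡⟨ m<n⇒m%n≡m (toℕ<n j) ⟩
    toℕ j                                       ∎)
    where open ≡-Reasoning

  iterate-m : ∀ i → iterate i m ≡ i
  iterate-m i = toℕ-injective (trans (toℕ-iterate i m) (trans (shift-+n (toℕ i) 0) (sym (toℕ-self i))))

  next-induction : (X : Fin m → Set) → ∀ {i₀} → X i₀ → (∀ i → X i → X (next i)) → ∀ i → X i
  next-induction X {i₀} X₀ step i = subst X (iterate-reaches i₀ i) (go (toℕ i + (m ∸ toℕ i₀)))
    where
      go : ∀ r → X (iterate i₀ r)
      go zero    = X₀
      go (suc r) = step _ (go r)

  two-neighbours-on-hole : ∀ i u w → (∀ j → adj G (h i) (h j) ≡ true → h j ≡ u ⊎ h j ≡ w) →
                           OnHole u × OnHole w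
  two-neighbours-on-hole i u w among with among _ (adj-next i) | among _ (adj-prev i)
  ... | inj₁ n≡u | inj₂ p≡w = (_ , n≡u) , (_ , p≡w)
  ... | inj₂ n≡w | inj₁ p≡u = (_ , p≡u) , (_ , n≡w)
  ... | inj₁ n≡u | inj₁ p≡u = ⊥-elim (next≢prev i (h-injective (trans n≡u (sym p≡u))))
  ... | inj₂ n≡w | inj₂ p≡w = ⊥-elim (next≢prev i (h-injective (trans n≡w (sym p≡w))))

  one-of-two-on-hole : ∀ i u w z → (∀ j → adj G (h i) (h j) ≡ true → h j ≡ u ⊎ h j ≡ w ⊎ h j ≡ z) →
                       OnHole u ⊎ OnHole w
  one-of-two-on-hole i u w z among with among _ (adj-next i) | among _ (adj-prev i)
  ... | inj₁ n≡u        | _               = inj₁ (_ , n≡u)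
  ... | inj₂ (inj₁ n≡w) | _               = inj₂ (_ , n≡w)
  ... | _               | inj₁ p≡u        = inj₁ (_ , p≡u)
  ... | _               | inj₂ (inj₁ p≡w) = inj₂ (_ , p≡w)
  ... | inj₂ (inj₂ n≡z) | inj₂ (inj₂ p≡z) = ⊥-elim (next≢prev i (h-injective (trans n≡z (sym p≡z))))

  next-one-of : ∀ i {j₁ j₂} → adj G (h i) (h j₁) ≡ true → adj G (h i) (h j₂) ≡ true → j₁ ≢ j₂ →
                next i ≡ j₁ ⊎ next i ≡ j₂
  next-one-of i {j₁} {j₂} e₁ e₂ j₁≢j₂ with adj⇒next⊎prev i j₁ e₁ | adj⇒next⊎prev i j₂ e₂
  ... | inj₁ j₁≡ | _        = inj₁ (sym j₁≡)
  ... | _        | inj₁ j₂≡ = inj₂ (sym j₂≡)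
  ... | inj₂ j₁≡ | inj₂ j₂≡ = ⊥-elim (j₁≢j₂ (trans j₁≡ (sym j₂≡)))

bipartite⇒even-hole : ∀ {G} → Bipartite G → ∀ {m h} → IsHole G m h → Even m
bipartite⇒even-hole {G} (colour , proper) {m} {h} H =
  parity≡false⇒even m (xor-absorbs (trans (cong (λ i → colour (h i)) (sym (iterate-m i₀))) (colour-iterate m)))
  where
    open Hole {G} H
    i₀ : Fin m
    i₀ = fromℕ< (≤-trans (s≤s z≤n) 4≤m)
    colour-iterate : ∀ r → colour (h (iterate i₀ r)) ≡ colour (h i₀) xor parity r
    colour-iterate zero    = sym (xor-identityʳ _)
    colour-iterate (suc r) = begin
      colour (h (next (iterate i₀ r)))    ≡⟨ ¬-not (λ e → proper _ _ (≡true⇒T (adj-next (iterate i₀ r))) (sym e)) ⟩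
      not (colour (h (iterate i₀ r)))     ≡⟨ cong not (colour-iterate r) ⟩
      not (colour (h i₀) xor parity r)    ≡⟨ not-distribʳ-xor (colour (h i₀)) (parity r) ⟩
      colour (h i₀) xor parity (suc r)    ∎
      where open ≡-Reasoning
    xor-absorbs : ∀ {x y} → x ≡ x xor y → y ≡ false
    xor-absorbs {false} {false} _ = refl
    xor-absorbs {true}  {false} _ = refl
    xor-absorbs {false} {true}  ()
    xor-absorbs {true}  {true}  ()

bipartite⇒no-triangle : ∀ {G} → Bipartite G → ∀ {u v w} →
                        T (adj G u v) → T (adj G v w) → T (adj G u w) → ⊥
bipartite⇒no-triangle (colour , proper) {u} {v} {w} uv vw uw
  with colour u in cu | colour v in cv | colour w in cw
... | false | false | _     = proper _ _ uv (trans cu (sym cv))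
... | true  | true  | _     = proper _ _ uv (trans cu (sym cv))
... | false | true  | false = proper _ _ uw (trans cu (sym cw))
... | false | true  | true  = proper _ _ vw (trans cv (sym cw))
... | true  | false | false = proper _ _ vw (trans cv (sym cw))
... | true  | false | true  = proper _ _ uw (trans cu (sym cw))

module HoleCount {G : Graph} (_≟_ : DecidableEquality (V G)) {m : ℕ} {h : Fin m → V G}
                 (H : IsHole G m h) where

  open Hole {G} H

  private
    vertices : List (V G)
    vertices = map h (allFin m)

    vertices-unique : Unique vertices
    vertices-unique = Unique.map⁺ h-injective (Unique.allFin⁺ m)

    ∈vertices : ∀ i → h i ∈ vertices
    ∈vertices i = ∈-map⁺ h (∈-allFin i)

    vertices-onHole : ∀ {v} → v ∈ vertices → OnHole v
    vertices-onHole v∈ with ∈-map⁻ h v∈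
    ... | i , _ , v≡hi = i , sym v≡hi

    Nbrs : V G → List (V G)
    Nbrs c = filterᵇ (adj G c) vertices

    nbrCount≡length-Nbrs : ∀ c → nbrCount G c m h ≡ length (Nbrs c)
    nbrCount≡length-Nbrs c = length-filterᵇ-map (adj G c) h (allFin m)

    Nbrs-unique : ∀ c → Unique (Nbrs c)
    Nbrs-unique c = Unique.filter⁺ (λ v → T? (adj G c v)) vertices-unique

    Nbrs⊆ : ∀ c {L : List (V G)} → (∀ i → adj G c (h i) ≡ true → h i ∈ L) → ∀ {v} → v ∈ Nbrs c → v ∈ L
    Nbrs⊆ c covers v∈ with ∈-filter⁻ (λ v → T? (adj G c v)) {xs = vertices} v∈
    ... | v∈vs , cv with vertices-onHole v∈vs
    ... | i , refl = covers i (T⇒≡true cv)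

  nbrCount-≡ : ∀ c (L : List (V G)) → Unique L → (∀ i → adj G c (h i) ≡ true → h i ∈ L) →
               (∀ {v} → v ∈ L → OnHole v × adj G c v ≡ true) → nbrCount G c m h ≡ length L
  nbrCount-≡ c L L-unique covers within = trans (nbrCount≡length-Nbrs c)
    (unique-⊆-⊇⇒length-≡ (Nbrs-unique c) L-unique (Nbrs⊆ c covers) L⊆)
    where
      L⊆ : ∀ {v} → v ∈ L → v ∈ Nbrs c
      L⊆ v∈ with within v∈
      ... | (i , refl) , cv = ∈-filter⁺ (λ v → T? (adj G c v)) (∈vertices i) (≡true⇒T cv)

  nbrCount-≤ : ∀ c (L : List (V G)) → (∀ i → adj G c (h i) ≡ true → h i ∈ L) → nbrCount G c m h ≤ length L
  nbrCount-≤ c L covers = subst (_≤ length L) (sym (nbrCount≡length-Nbrs c))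
    (unique-⊆⇒length-≤ _≟_ (Nbrs-unique c) (Nbrs⊆ c covers))

  m≡length : ∀ (L : List (V G)) → Unique L → (∀ i → h i ∈ L) → (∀ {v} → v ∈ L → OnHole v) → m ≡ length L
  m≡length L L-unique covers within = trans (sym (trans (length-map h (allFin m)) (length-tabulate (λ i → i))))
    (unique-⊆-⊇⇒length-≡ vertices-unique L-unique vs⊆L L⊆vs)
    where
      vs⊆L : ∀ {v} → v ∈ vertices → v ∈ L
      vs⊆L v∈ with vertices-onHole v∈
      ... | i , refl = covers i
      L⊆vs : ∀ {v} → v ∈ L → v ∈ vertices
      L⊆vs v∈ with within v∈
      ... | i , refl = ∈vertices i

  nbrCount-on-hole : ∀ i → nbrCount G (h i) m h ≡ 2
  nbrCount-on-hole i = nbrCount-≡ (h i) (h (next i) ∷ h (prev i) ∷ []) unique covers within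
    where
      unique : Unique (h (next i) ∷ h (prev i) ∷ [])
      unique = ((λ e → next≢prev i (h-injective e)) ∷ []) ∷ ([] ∷ [])
      covers : ∀ j → adj G (h i) (h j) ≡ true → h j ∈ (h (next i) ∷ h (prev i) ∷ [])
      covers j e with adj⇒next⊎prev i j e
      ... | inj₁ refl = here refl
      ... | inj₂ refl = there (here refl)
      within : ∀ {v} → v ∈ (h (next i) ∷ h (prev i) ∷ []) → OnHole v × adj G (h i) v ≡ true
      within (here refl)         = (_ , refl) , adj-next i
      within (there (here refl)) = (_ , refl) , adj-prev i

-- Induced paths and glued holes

IsInducedPath : (G : Graph) → (ℕ → V G) → ℕ → Set
IsInducedPath G P p =
  (∀ u v → u ≤ p → v ≤ p → adj G (P u) (P v) ≡ ((suc u ≡ᵇ v) ∨ (suc v ≡ᵇ u)))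
  × (∀ u v → u ≤ p → v ≤ p → P u ≡ P v → u ≡ v)

induced-subpath : ∀ {G P p} → IsInducedPath G P p → ∀ a {q} → a + q ≤ p →
                  IsInducedPath G (λ v → P (a + v)) q
induced-subpath {G} {P} {p} (P-adj , P-inj) a {q} a+q≤p = Q-adj , Q-inj
  where
    within : ∀ {v} → v ≤ q → a + v ≤ p
    within v≤q = ≤-trans (+-monoʳ-≤ a v≤q) a+q≤p
    Q-adj : ∀ u v → u ≤ q → v ≤ q → adj G (P (a + u)) (P (a + v)) ≡ ((suc u ≡ᵇ v) ∨ (suc v ≡ᵇ u))
    Q-adj u v u≤q v≤q rewrite P-adj (a + u) (a + v) (within u≤q) (within v≤q)
      | sym (+-suc a u) | sym (+-suc a v) | ≡ᵇ-+ a (suc u) v | ≡ᵇ-+ a (suc v) u = refl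
    Q-inj : ∀ u v → u ≤ q → v ≤ q → P (a + u) ≡ P (a + v) → u ≡ v
    Q-inj u v u≤q v≤q e = +-cancelˡ-≡ a u v (P-inj (a + u) (a + v) (within u≤q) (within v≤q) e)

module Glue {G : Graph} (adj-sym : ∀ x y → adj G x y ≡ adj G y x)
            {P Q : ℕ → V G} {p q : ℕ} (P-path : IsInducedPath G P p) (Q-path : IsInducedPath G Q q)
            (P≢Q : ∀ u w → u ≤ p → w ≤ q → P u ≢ Q w)
            (P-Q-adj : ∀ u w → u ≤ p → w ≤ q →
                       adj G (P u) (Q w) ≡ (((u ≡ᵇ p) ∧ (w ≡ᵇ 0)) ∨ ((u ≡ᵇ 0) ∧ (w ≡ᵇ q))))
            (2≤p+q : 2 ≤ p + q) where

  m : ℕ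
  m = suc p + suc q

  private
    vertex′ : ∀ u → Dec (u ≤ p) → V G
    vertex′ u (yes _) = P u
    vertex′ u (no _)  = Q (u ∸ suc p)

    vertex : ℕ → V G
    vertex u = vertex′ u (u ≤? p)

    data Position (u : ℕ) (x : V G) : Set where
      onP : u ≤ p → x ≡ P u → Position u x
      onQ : ∀ w → w ≤ q → u ≡ suc p + w → x ≡ Q w → Position u x

    position′ : ∀ {u} → u < m → (u≤?p : Dec (u ≤ p)) → Position u (vertex′ u u≤?p)
    position′ u<m (yes u≤p) = onP u≤p refl
    position′ {u} u<m (no u≰p) = onQ (u ∸ suc p) (s≤s⁻¹ (+-cancelˡ-< (suc p) _ (suc q) (subst (_< m) u≡ u<m))) u≡ refl
      where
        u≡ : u ≡ suc p + (u ∸ suc p)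
        u≡ = sym (m+[n∸m]≡n (≰⇒> u≰p))

    position : ∀ {u} → u < m → Position u (vertex u)
    position {u} u<m = position′ u<m (u ≤? p)

    ≤p⇒1+<m : ∀ {u} → u ≤ p → suc u < m
    ≤p⇒1+<m u≤p = s≤s (≤-trans (s≤s (≤-trans u≤p (m≤m+n p q))) (≤-reflexive (sym (+-suc p q))))

    adj-PP : ∀ u v → u ≤ p → v ≤ p → adj G (P u) (P v) ≡ cycAdj m u v
    adj-PP u v u≤p v≤p = trans (proj₁ P-path u v u≤p v≤p) (sym (cycAdj-interior (≤p⇒1+<m u≤p) (≤p⇒1+<m v≤p)))

    adj-QQ : ∀ w₁ w₂ → w₁ ≤ q → w₂ ≤ q → adj G (Q w₁) (Q w₂) ≡ cycAdj m (suc p + w₁) (suc p + w₂)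
    adj-QQ w₁ w₂ w₁≤q w₂≤q rewrite proj₁ Q-path w₁ w₂ w₁≤q w₂≤q | sym (+-suc p w₁) | sym (+-suc p w₂)
      | ≡ᵇ-+ p (suc w₁) w₂ | ≡ᵇ-+ p (suc w₂) w₁ | ∨-identityʳ (suc w₂ ≡ᵇ w₁) = refl

    P-end-meets-Q : ∀ u w → u ≤ p → (u ≡ᵇ p + w) ≡ ((u ≡ᵇ p) ∧ (w ≡ᵇ 0))
    P-end-meets-Q u zero    u≤p rewrite +-identityʳ p | ∧-identityʳ (u ≡ᵇ p) = refl
    P-end-meets-Q u (suc w) u≤p rewrite ∧-zeroʳ (u ≡ᵇ p) =
      ≡ᵇ-false (λ e → <⇒≱ (≤-trans (s≤s (m≤m+n p w)) (≤-reflexive (trans (sym (+-suc p w)) (sym e)))) u≤p)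

    Q-beyond-P : ∀ u w → u ≤ p → suc (suc p + w) ≢ u
    Q-beyond-P u w u≤p e = <⇒≱ (s≤s (≤-trans (m≤m+n p w) (n≤1+n _))) (≤-trans (≤-reflexive e) u≤p)

    Q-end-wraps : ∀ w → (suc (suc p + w) ≡ᵇ m) ≡ (w ≡ᵇ q)
    Q-end-wraps w rewrite sym (+-suc p w) = ≡ᵇ-+ p (suc w) (suc q)

    adj-PQ : ∀ u w → u ≤ p → w ≤ q → adj G (P u) (Q w) ≡ cycAdj m u (suc p + w)
    adj-PQ u w u≤p w≤q rewrite P-Q-adj u w u≤p w≤q | P-end-meets-Q u w u≤p | ≡ᵇ-false (Q-beyond-P u w u≤p)
      | Q-end-wraps w | ∨-identityʳ ((u ≡ᵇ 0) ∧ (w ≡ᵇ q)) = refl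

    vertex-adj : ∀ u v → u < m → v < m → adj G (vertex u) (vertex v) ≡ cycAdj m u v
    vertex-adj u v u<m v<m with position u<m | position v<m
    ... | onP u≤p eu | onP v≤p ev rewrite eu | ev = adj-PP u v u≤p v≤p
    ... | onP u≤p eu | onQ w w≤q refl ev rewrite eu | ev = adj-PQ u w u≤p w≤q
    ... | onQ w w≤q refl eu | onP v≤p ev rewrite eu | ev =
          trans (adj-sym (Q w) (P v)) (trans (adj-PQ v w v≤p w≤q) (cycAdj-sym m v (suc p + w)))
    ... | onQ w₁ w₁≤q refl eu | onQ w₂ w₂≤q refl ev rewrite eu | ev = adj-QQ w₁ w₂ w₁≤q w₂≤q

    vertex-injective : ∀ u v → u < m → v < m → vertex u ≡ vertex v → u ≡ v
    vertex-injective u v u<m v<m e with position u<m | position v<m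
    ... | onP u≤p eu | onP v≤p ev = proj₂ P-path u v u≤p v≤p (trans (sym eu) (trans e ev))
    ... | onP u≤p eu | onQ w w≤q _ ev = ⊥-elim (P≢Q u w u≤p w≤q (trans (sym eu) (trans e ev)))
    ... | onQ w w≤q _ eu | onP v≤p ev = ⊥-elim (P≢Q v w v≤p w≤q (sym (trans (sym eu) (trans e ev))))
    ... | onQ w₁ w₁≤q refl eu | onQ w₂ w₂≤q refl ev =
          cong (suc p +_) (proj₂ Q-path w₁ w₂ w₁≤q w₂≤q (trans (sym eu) (trans e ev)))

  cycle : Fin m → V G
  cycle i = vertex (toℕ i)

  cycle-isHole : IsHole G m cycle
  cycle-isHole = subst (4 ≤_) (sym (+-suc (suc p) q)) (s≤s (s≤s 2≤p+q))
               , (λ {i} {j} e → toℕ-injective (vertex-injective (toℕ i) (toℕ j) (toℕ<n i) (toℕ<n j) e))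
               , λ i j → vertex-adj (toℕ i) (toℕ j) (toℕ<n i) (toℕ<n j)

  cycle-onPaths : ∀ i → (Σ ℕ λ u → u ≤ p × cycle i ≡ P u) ⊎ (Σ ℕ λ w → w ≤ q × cycle i ≡ Q w)
  cycle-onPaths i with position (toℕ<n i)
  ... | onP u≤p e     = inj₁ (_ , u≤p , e)
  ... | onQ w w≤q _ e = inj₂ (w , w≤q , e)

  Q-onCycle : ∀ {w} → w ≤ q → Σ (Fin m) λ i → cycle i ≡ Q w
  Q-onCycle {w} w≤q with position (+-monoʳ-< (suc p) (s≤s w≤q))
  ... | onP u≤p _ = ⊥-elim (<⇒≱ (s≤s (m≤m+n p w)) u≤p)
  ... | onQ w′ _ e eq = fromℕ< i<m , trans (cong vertex (toℕ-fromℕ< i<m)) (trans eq (cong Q (sym (+-cancelˡ-≡ (suc p) w w′ e))))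
    where
      i<m : suc p + w < m
      i<m = +-monoʳ-< (suc p) (s≤s w≤q)

module HoleMinusVertex {G : Graph} {m : ℕ} {h : Fin m → V G} (H : IsHole G m h) (i : Fin m) where

  open Hole {G} H
  open Cyclic m

  index : ℕ → Fin m
  index u = (toℕ i + suc u) mod m

  path : ℕ → V G
  path u = h (index u)

  private
    toℕ-index : ∀ u → toℕ (index u) ≡ shift (toℕ i) (suc u)
    toℕ-index u = toℕ-fromℕ< _

    m≡2+[m∸2] : m ≡ suc (suc (m ∸ 2))
    m≡2+[m∸2] = sym (m+[n∸m]≡n (≤-trans (s≤s (s≤s z≤n)) 4≤m))

    ≤m∸2⇒1+<m : ∀ {u} → u ≤ m ∸ 2 → suc (suc u) ≤ m
    ≤m∸2⇒1+<m u≤ = ≤-trans (s≤s (s≤s u≤)) (≤-reflexive (sym m≡2+[m∸2]))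

  path-isInducedPath : IsInducedPath G path (m ∸ 2)
  path-isInducedPath = path-adj , path-injective
    where
      path-adj : ∀ u v → u ≤ m ∸ 2 → v ≤ m ∸ 2 → adj G (path u) (path v) ≡ ((suc u ≡ᵇ v) ∨ (suc v ≡ᵇ u))
      path-adj u v u≤ v≤ = begin
        adj G (path u) (path v)                                ≡⟨ h-adj (index u) (index v) ⟩
        cycAdj m (toℕ (index u)) (toℕ (index v))               ≡⟨ cong₂ (cycAdj m) (toℕ-index u) (toℕ-index v) ⟩
        cycAdj m (shift (toℕ i) (suc u)) (shift (toℕ i) (suc v)) ≡⟨ cycAdj-shift (toℕ i) (≤m∸2⇒1+<m u≤) (≤m∸2⇒1+<m v≤) ⟩
        cycAdj m (suc u) (suc v)                               ≡⟨ cong ((suc u ≡ᵇ v) ∨_) (∨-identityʳ (suc v ≡ᵇ u)) ⟩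
        (suc u ≡ᵇ v) ∨ (suc v ≡ᵇ u)                            ∎
        where open ≡-Reasoning
      path-injective : ∀ u v → u ≤ m ∸ 2 → v ≤ m ∸ 2 → path u ≡ path v → u ≡ v
      path-injective u v u≤ v≤ e = suc-injective (shift-injective (toℕ i) (≤m∸2⇒1+<m u≤) (≤m∸2⇒1+<m v≤)
        (trans (sym (toℕ-index u)) (trans (cong toℕ (h-injective e)) (toℕ-index v))))

  index-vs-prev : ∀ {u} → u ≤ m ∸ 2 → (toℕ (index u) ≡ᵇ toℕ (prev i)) ≡ (u ≡ᵇ m ∸ 2)
  index-vs-prev {u} u≤ rewrite toℕ-index u | toℕ-prev i | shiftᵇ (toℕ i) (≤m∸2⇒1+<m u≤) m∸1<m
                             | cong (_∸ 1) m≡2+[m∸2] = refl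

  index-vs-next : ∀ {u} → u ≤ m ∸ 2 → (toℕ (index u) ≡ᵇ toℕ (next i)) ≡ (u ≡ᵇ 0)
  index-vs-next {u} u≤ rewrite toℕ-index u | toℕ-next i = shiftᵇ (toℕ i) (≤m∸2⇒1+<m u≤) 1<m

  index-vs-self : ∀ {u} → u ≤ m ∸ 2 → (toℕ (index u) ≡ᵇ toℕ i) ≡ false
  index-vs-self {u} u≤ rewrite toℕ-index u =
    trans (cong (shift (toℕ i) (suc u) ≡ᵇ_) (toℕ-self i)) (shiftᵇ (toℕ i) (≤m∸2⇒1+<m u≤) (≤-trans (s≤s z≤n) 1<m))

module Daisy (d : DaisyData) where

  L : Fin (l d) → ℕ
  L = len d

  C-isHole : IsHole (daisy d) (k d) inj₁
  C-isHole = 4≤k d , (λ { refl → refl }) , λ _ _ → refl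

  module C = Hole {daisy d} C-isHole

  instance
    k-nonZero : NonZero (k d)
    k-nonZero = C.m-nonZero

  _≟V_ : DecidableEquality (DV d)
  _≟V_ = Sum.≡-dec Fin._≟_ (Product.≡-dec Fin._≟_ Fin._≟_)

  dAdj-sym : ∀ x y → dAdj d x y ≡ dAdj d y x
  dAdj-sym (inj₁ a)       (inj₁ b)         = cycAdj-sym (k d) (toℕ a) (toℕ b)
  dAdj-sym (inj₁ a)       (inj₂ _)         = refl
  dAdj-sym (inj₂ _)       (inj₁ b)         = refl
  dAdj-sym (inj₂ (j , t)) (inj₂ (j′ , t′))
    rewrite ≡ᵇ-sym (toℕ j) (toℕ j′) | ∨-comm (suc (toℕ t) ≡ᵇ toℕ t′) (suc (toℕ t′) ≡ᵇ toℕ t) = refl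

  pr ce nx : Fin (l d) → Fin (k d)
  ce j = centre d j
  pr j = prevC d (ce j)
  nx j = nextC d (ce j)

  centre-injective : ∀ {j j′} → ce j ≡ ce j′ → j ≡ j′
  centre-injective {j} {j′} e = toℕ-injective (Cyclic.shift-injective (k d) (toℕ (s d))
    (≤-trans (toℕ<n j) (l≤k d)) (≤-trans (toℕ<n j′) (l≤k d))
    (trans (sym (toℕ-fromℕ< _)) (trans (cong toℕ e) (toℕ-fromℕ< _))))

  prev≢self : ∀ a → prevC d a ≢ a
  prev≢self a e = C.adjacent⇒≢ (C.adj-prev a) (sym e)

  self≢next : ∀ a → a ≢ nextC d a
  self≢next a = C.adjacent⇒≢ (C.adj-next a)

  prev≢next : ∀ a → prevC d a ≢ nextC d a
  prev≢next a e = C.next≢prev a (sym e)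

  private
    ≢⇒≡ᵇ-false : ∀ {a b : Fin (k d)} → a ≢ b → (toℕ a ≡ᵇ toℕ b) ≡ false
    ≢⇒≡ᵇ-false a≢b = ≡ᵇ-false (λ e → a≢b (toℕ-injective e))

  adj-prev-petal : ∀ j t → dAdj d (inj₁ (pr j)) (petal d j t) ≡ (toℕ t ≡ᵇ 0)
  adj-prev-petal j t rewrite ≡ᵇ-refl (toℕ (pr j)) | ≢⇒≡ᵇ-false (prev≢next (ce j))
                           | ≢⇒≡ᵇ-false (prev≢self (ce j)) = ∨-identityʳ _

  adj-next-petal : ∀ j t → dAdj d (inj₁ (nx j)) (petal d j t) ≡ (toℕ t ≡ᵇ L j)
  adj-next-petal j t rewrite ≡ᵇ-refl (toℕ (nx j)) | ≢⇒≡ᵇ-false (λ e → prev≢next (ce j) (sym e))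
                           | ≢⇒≡ᵇ-false (λ e → self≢next (ce j) (sym e)) = ∨-identityʳ _

  adj-centre-petal : ∀ j t → dAdj d (centreV d j) (petal d j t) ≡ att d j t
  adj-centre-petal j t rewrite ≡ᵇ-refl (toℕ (ce j)) | ≢⇒≡ᵇ-false (λ e → prev≢self (ce j) (sym e))
                             | ≢⇒≡ᵇ-false (self≢next (ce j)) = refl

  R-petal : ∀ j t → R d j (suc (toℕ t)) ≡ petal d j t
  R-petal j t with toℕ t <? suc (L j)
  ... | yes t< = cong (petal d j) (fromℕ<-toℕ t t<)
  ... | no  t≮ = ⊥-elim (t≮ (toℕ<n t))

  R-end : ∀ j → R d j (suc (suc (L j))) ≡ inj₁ (nx j)
  R-end j with suc (L j) <? suc (L j)
  ... | yes L<L = ⊥-elim (<-irrefl refl L<L)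
  ... | no  _   = refl

  data Position (j : Fin (l d)) : ℕ → Set where
    start : Position j 0
    inner : (t : Fin (suc (L j))) → Position j (suc (toℕ t))
    end   : Position j (suc (suc (L j)))

  position : ∀ j {u} → u ≤ suc (suc (L j)) → Position j u
  position j {zero}  _  = start
  position j {suc u} u≤ with u <? suc (L j)
  ... | yes u< = subst (Position j) (cong suc (toℕ-fromℕ< u<)) (inner (fromℕ< u<))
  ... | no  u≮ = subst (Position j) (cong suc (sym (≤-antisym (s≤s⁻¹ u≤) (≮⇒≥ u≮)))) end

  R-isInducedPath : ∀ j → IsInducedPath (daisy d) (R d j) (suc (suc (L j)))
  R-isInducedPath j = R-adj , R-injective
    where
      beyond : ∀ (t : Fin (suc (L j))) → (suc (suc (L j)) ≡ᵇ toℕ t) ≡ false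
      beyond t = ≡ᵇ-false (λ e → <⇒≱ (≤-trans (toℕ<n t) (n≤1+n _)) (≤-reflexive e))
      R-adj : ∀ u v → u ≤ suc (suc (L j)) → v ≤ suc (suc (L j)) →
              dAdj d (R d j u) (R d j v) ≡ ((suc u ≡ᵇ v) ∨ (suc v ≡ᵇ u))
      R-adj u v u≤ v≤ with position j u≤ | position j v≤
      ... | start   | start    = C.adj-self (pr j)
      ... | start   | inner t  rewrite R-petal j t | adj-prev-petal j t = trans (≡ᵇ-sym (toℕ t) 0) (sym (∨-identityʳ _))
      ... | start   | end      rewrite R-end j = C.adj-prev-next (ce j)
      ... | inner t | start    rewrite R-petal j t | adj-prev-petal j t = ≡ᵇ-sym (toℕ t) 0
      ... | inner t | inner t′ rewrite R-petal j t | R-petal j t′ | ≡ᵇ-refl (toℕ j) = refl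
      ... | inner t | end      rewrite R-petal j t | R-end j | adj-next-petal j t | beyond t = sym (∨-identityʳ _)
      ... | end     | start    rewrite R-end j = trans (cycAdj-sym (k d) (toℕ (nx j)) (toℕ (pr j))) (C.adj-prev-next (ce j))
      ... | end     | inner t  rewrite R-petal j t | R-end j | adj-next-petal j t | beyond t = refl
      ... | end     | end      rewrite R-end j | ≡ᵇ-false {suc (L j)} {L j} 1+n≢n = C.adj-self (nx j)
      R-injective : ∀ u v → u ≤ suc (suc (L j)) → v ≤ suc (suc (L j)) → R d j u ≡ R d j v → u ≡ v
      R-injective u v u≤ v≤ e with position j u≤ | position j v≤
      ... | start   | start    = refl
      ... | start   | inner t  rewrite R-petal j t with () ← e
      ... | start   | end      rewrite R-end j = ⊥-elim (prev≢next (ce j) (inj₁-injective e))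
      ... | inner t | start    rewrite R-petal j t with () ← e
      ... | inner t | inner t′ rewrite R-petal j t | R-petal j t′ with refl ← e = refl
      ... | inner t | end      rewrite R-petal j t | R-end j with () ← e
      ... | end     | start    rewrite R-end j = ⊥-elim (prev≢next (ce j) (sym (inj₁-injective e)))
      ... | end     | inner t  rewrite R-petal j t | R-end j with () ← e
      ... | end     | end      = refl

  R-at : ∀ j (t : Fin (suc (L j))) {u} → toℕ t ≡ u → R d j (suc u) ≡ petal d j t
  R-at j t refl = R-petal j t

  R-last : ∀ j → R d j (suc (L j)) ≡ petal d j (fromℕ (L j))
  R-last j = R-at j (fromℕ (L j)) (toℕ-fromℕ (L j))

  data CPEdge (a : Fin (k d)) (j : Fin (l d)) (t : Fin (suc (L j))) : Set where
    at-start  : a ≡ pr j → toℕ t ≡ 0   → CPEdge a j t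
    at-end    : a ≡ nx j → toℕ t ≡ L j → CPEdge a j t
    at-centre : a ≡ ce j → att d j t ≡ true → CPEdge a j t

  cp-edge : ∀ a j t → dAdj d (inj₁ a) (petal d j t) ≡ true → CPEdge a j t
  cp-edge a j t e with Equivalence.to T-∨ (≡true⇒T e)
  ... | inj₁ e₁ = let a≡ , t≡ = Equivalence.to T-∧ e₁ in at-start (toℕ-injective (≡ᵇ⇒≡ _ _ a≡)) (≡ᵇ⇒≡ _ _ t≡)
  ... | inj₂ e₂ with Equivalence.to T-∨ e₂
  ... | inj₁ e₃ = let a≡ , t≡ = Equivalence.to T-∧ e₃ in at-end (toℕ-injective (≡ᵇ⇒≡ _ _ a≡)) (≡ᵇ⇒≡ _ _ t≡)
  ... | inj₂ e₃ = let a≡ , at = Equivalence.to T-∧ e₃ in at-centre (toℕ-injective (≡ᵇ⇒≡ _ _ a≡)) (T⇒≡true at)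

  data PetalNeighbour (j : Fin (l d)) (t : Fin (suc (L j))) (w : DV d) : Set where
    before   : w ≡ R d j (toℕ t) → PetalNeighbour j t w
    after    : w ≡ R d j (suc (suc (toℕ t))) → PetalNeighbour j t w
    attached : att d j t ≡ true → w ≡ centreV d j → PetalNeighbour j t w

  petal-neighbour : ∀ j t w → dAdj d (petal d j t) w ≡ true → PetalNeighbour j t w
  petal-neighbour j t (inj₁ a) e with cp-edge a j t e
  ... | at-start  refl t≡0 = before (cong (R d j) (sym t≡0))
  ... | at-end    refl t≡L = after (sym (trans (cong (λ u → R d j (suc (suc u))) t≡L) (R-end j)))
  ... | at-centre refl at = attached at refl
  petal-neighbour j t (inj₂ (j′ , t′)) e with Equivalence.to T-∧ (≡true⇒T e)
  ... | j≡j′ , t~t′ with toℕ-injective (≡ᵇ⇒≡ (toℕ j) (toℕ j′) j≡j′)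
  ... | refl with Equivalence.to T-∨ t~t′
  ... | inj₁ t+1≡t′ = after (sym (R-at j t′ (sym (≡ᵇ⇒≡ _ _ t+1≡t′))))
  ... | inj₂ t′+1≡t = before (sym (trans (cong (R d j) (sym (≡ᵇ⇒≡ (suc (toℕ t′)) (toℕ t) t′+1≡t))) (R-petal j t′)))

  data CNeighbour (a : Fin (k d)) (w : DV d) : Set where
    cycle-next  : w ≡ inj₁ (nextC d a) → CNeighbour a w
    cycle-prev  : w ≡ inj₁ (prevC d a) → CNeighbour a w
    petal-start : ∀ j → pr j ≡ a → w ≡ R d j 1 → CNeighbour a w
    petal-end   : ∀ j → nx j ≡ a → w ≡ R d j (suc (L j)) → CNeighbour a w
    attachment  : ∀ j t → ce j ≡ a → att d j t ≡ true → w ≡ petal d j t → CNeighbour a w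

  C-neighbour : ∀ a w → dAdj d (inj₁ a) w ≡ true → CNeighbour a w
  C-neighbour a (inj₁ b) e with C.adj⇒next⊎prev a b e
  ... | inj₁ refl = cycle-next refl
  ... | inj₂ refl = cycle-prev refl
  C-neighbour a (inj₂ (j , t)) e with cp-edge a j t e
  ... | at-start  refl t≡0 = petal-start j refl (sym (R-at j t t≡0))
  ... | at-end    refl t≡L = petal-end j refl (sym (R-at j t t≡L))
  ... | at-centre refl at  = attachment j t refl at refl

  A : Fin (l d) → ℕ → Bool
  A j u = dAdj d (centreV d j) (R d j u)

  A-start : ∀ j → A j 0 ≡ true
  A-start j = C.adj-prev (ce j)

  A-end : ∀ j → A j (suc (suc (L j))) ≡ true
  A-end j rewrite R-end j = C.adj-next (ce j)

  A-petal : ∀ j t → A j (suc (toℕ t)) ≡ att d j t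
  A-petal j t rewrite R-petal j t = adj-centre-petal j t

  att-first : ∀ j (t : Fin (suc (L j))) → toℕ t ≡ 0 → att d j t ≡ false
  att-first j t t≡0 with att d j t in at
  ... | false = refl
  ... | true  = ⊥-elim (<⇒≢ (proj₁ (att-internal d j t (≡true⇒T at))) (sym t≡0))

  att-last : ∀ j (t : Fin (suc (L j))) → toℕ t ≡ L j → att d j t ≡ false
  att-last j t t≡L with att d j t in at
  ... | false = refl
  ... | true  = ⊥-elim (<⇒≢ (proj₂ (att-internal d j t (≡true⇒T at))) t≡L)

  module SectorGaps (j : Fin (l d)) = Gaps (A j) (A-start j)

  petalNbrs≡count : ∀ j → petalNbrs d j ≡ SectorGaps.count j (suc (L j))
  petalNbrs≡count j = length-filterᵇ-allFin (suc (L j)) _ (λ u → A j (suc u))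
                        (λ t → cong (dAdj d (centreV d j)) (sym (R-petal j t)))

  petalNbrs≥1 : ∀ j → 1 ≤ petalNbrs d j
  petalNbrs≥1 j with att-nonempty d j
  ... | t , at = subst (1 ≤_) (sym (petalNbrs≡count j))
                   (countTrue-positive (λ u → A j (suc u)) (toℕ<n t) (trans (A-petal j t) (T⇒≡true at)))

  sector⇒gap : ∀ {j a b} → IsExtSector d j a b → b ≤ suc (suc (L j)) × SectorGaps.IsGap j a b
  sector⇒gap {j} {a} {b} (a<b , b≤ , Aa , Ab , inside) = subst (b ≤_) (+-comm (L j) 2) b≤ , a<b , Aa , Ab , inside

  gap⇒sector : ∀ {j a b} → b ≤ suc (suc (L j)) → SectorGaps.IsGap j a b → IsExtSector d j a b
  gap⇒sector {j} {b = b} b≤ (a<b , Aa , Ab , inside) = a<b , subst (b ≤_) (+-comm 2 (L j)) b≤ , Aa , Ab , inside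

  centre∉R : ∀ j {u} → u ≤ suc (suc (L j)) → centreV d j ≢ R d j u
  centre∉R j u≤ e with position j u≤
  ... | start   = prev≢self (ce j) (sym (inj₁-injective e))
  ... | inner t with () ← trans e (R-petal j t)
  ... | end     = self≢next (ce j) (inj₁-injective (trans e (R-end j)))

  module _ j (odd-sectors : ∀ a b → IsExtSector d j a b → Odd (b ∸ a)) where

    odd-sectors⇒parity-len : parity (L j) ≡ not (parity (petalNbrs d j))
    odd-sectors⇒parity-len = begin
      parity (L j)                        ≡⟨ not-involutive (parity (L j)) ⟨
      parity (suc (suc (L j)))            ≡⟨ SG.odd-gaps⇒parity odd-gaps ≤-refl (A-end j) ⟩
      parity (SG.count (suc (suc (L j)))) ≡⟨ cong parity count-end ⟩
      parity (suc (SG.count (suc (L j)))) ≡⟨ cong (λ n → not (parity n)) (petalNbrs≡count j) ⟨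
      not (parity (petalNbrs d j))        ∎
      where
        open ≡-Reasoning
        module SG = SectorGaps j
        odd-gaps : ∀ a b → b ≤ suc (suc (L j)) → SG.IsGap a b → Odd (b ∸ a)
        odd-gaps a b b≤ gap = odd-sectors a b (gap⇒sector b≤ gap)
        count-end : SG.count (suc (suc (L j))) ≡ suc (SG.count (suc (L j)))
        count-end = trans (countTrue-suc (λ u → A j (suc u)) (suc (L j)))
                          (cong (λ b → indicator b + SG.count (suc (L j))) (A-end j))

  module _ j (even-sectors : ∀ a b → IsExtSector d j a b → Even (b ∸ a)) where

    private
      module SG = SectorGaps j
      even-gaps : ∀ a b → b ≤ suc (suc (L j)) → SG.IsGap a b → Even (b ∸ a)
      even-gaps a b b≤ gap = even-sectors a b (gap⇒sector b≤ gap)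

    even-sectors⇒parity-len : parity (L j) ≡ false
    even-sectors⇒parity-len = trans (sym (not-involutive (parity (L j)))) (SG.even-gaps⇒parity even-gaps ≤-refl (A-end j))

    even-sectors⇒parity-attachment : ∀ t → att d j t ≡ true → parity (suc (toℕ t)) ≡ false
    even-sectors⇒parity-attachment t at =
      SG.even-gaps⇒parity even-gaps (s≤s (m≤n⇒m≤1+n (s≤s⁻¹ (toℕ<n t)))) (trans (A-petal j t) at)

  R-adjacent : ∀ j {z} → suc z ≤ suc (suc (L j)) → dAdj d (R d j z) (R d j (suc z)) ≡ true
  R-adjacent j {z} z< rewrite proj₁ (R-isInducedPath j) z (suc z) (<⇒≤ z<) z< | ≡ᵇ-refl z = refl

  R-injective : ∀ j {u v} → u ≤ suc (suc (L j)) → v ≤ suc (suc (L j)) → R d j u ≡ R d j v → u ≡ v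
  R-injective j {u} {v} = proj₂ (R-isInducedPath j) u v

  private
    next-to-attachment : ∀ j {t t′} → att d j t ≡ true → suc (toℕ t′) ≡ toℕ t ⊎ suc (toℕ t) ≡ toℕ t′ →
                         att d j t′ ≡ false
    next-to-attachment j {t} {t′} at adjacent with att d j t′ in at′ | adjacent
    ... | false | _ = refl
    ... | true  | inj₁ t′+1≡t = ⊥-elim (att-sparse d j t′ t (≡true⇒T at′) (≡true⇒T at) t′+1≡t)
    ... | true  | inj₂ t+1≡t′ = ⊥-elim (att-sparse d j t t′ (≡true⇒T at) (≡true⇒T at′) t+1≡t′)

  A-before-attachment : ∀ j t → att d j t ≡ true → A j (toℕ t) ≡ false
  A-before-attachment j t at with toℕ t in t≡
  ... | zero  with () ← trans (sym at) (att-first j t t≡)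
  ... | suc v = trans (cong (λ w → A j (suc w)) (sym (toℕ-fromℕ< v<)))
                  (trans (A-petal j (fromℕ< v<)) (next-to-attachment j at (inj₁ (trans (cong suc (toℕ-fromℕ< v<)) (sym t≡)))))
    where
      v< : v < suc (L j)
      v< = <-trans (s≤s⁻¹ (subst (_< suc (L j)) t≡ (toℕ<n t))) (n<1+n (L j))

  A-after-attachment : ∀ j t → att d j t ≡ true → A j (suc (suc (toℕ t))) ≡ false
  A-after-attachment j t at = trans (cong (λ w → A j (suc w)) (sym (toℕ-fromℕ< t+1<)))
    (trans (A-petal j (fromℕ< t+1<)) (next-to-attachment j at (inj₂ (sym (toℕ-fromℕ< t+1<)))))
    where
      t+1< : suc (toℕ t) < suc (L j)
      t+1< = s≤s (proj₂ (att-internal d j t (≡true⇒T at)))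

-- Even wheels

module DaisyHole (d : DaisyData) {m : ℕ} {h : Fin m → DV d} (H : IsHole (daisy d) m h) where

  open Daisy d
  open Hole {daisy d} H
  open HoleCount {daisy d} _≟V_ H

  onHole? : ∀ v → Dec (OnHole v)
  onHole? v = any? (λ i → h i ≟V v)

  petal-neighbours-onHole : ∀ j t → att d j t ≡ false ⊎ ¬ OnHole (centreV d j) → OnHole (petal d j t) →
                            OnHole (R d j (toℕ t)) × OnHole (R d j (suc (suc (toℕ t))))
  petal-neighbours-onHole j t not-attached (i , hi≡) = two-neighbours-on-hole i _ _ along-R
    where
      along-R : ∀ i′ → dAdj d (h i) (h i′) ≡ true → h i′ ≡ R d j (toℕ t) ⊎ h i′ ≡ R d j (suc (suc (toℕ t)))
      along-R i′ e with petal-neighbour j t (h i′) (subst (λ x → dAdj d x (h i′) ≡ true) hi≡ e)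
      ... | before eq      = inj₁ eq
      ... | after  eq      = inj₂ eq
      ... | attached at eq = ⊥-elim (excluded not-attached)
        where
          excluded : att d j t ≡ false ⊎ ¬ OnHole (centreV d j) → ⊥
          excluded (inj₁ ¬at) with () ← trans (sym at) ¬at
          excluded (inj₂ c∉)  = c∉ (i′ , eq)

  start-onHole : ∀ j → OnHole (R d j 1) → OnHole (inj₁ (pr j))
  start-onHole j x∈ = proj₁ (petal-neighbours-onHole j Fin.zero (inj₁ (att-first j Fin.zero refl)) x∈)

  end-onHole : ∀ j → OnHole (R d j (suc (L j))) → OnHole (inj₁ (nx j))
  end-onHole j y∈ = subst OnHole R-after-y
    (proj₂ (petal-neighbours-onHole j (fromℕ (L j)) (inj₁ (att-last j _ (toℕ-fromℕ (L j)))) (subst OnHole (R-last j) y∈)))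
    where
      R-after-y : R d j (suc (suc (toℕ (fromℕ (L j))))) ≡ inj₁ (nx j)
      R-after-y = trans (cong (λ u → R d j (suc (suc u))) (toℕ-fromℕ (L j))) (R-end j)

  R-onHole : ∀ j → ¬ OnHole (centreV d j) → ∀ t → OnHole (petal d j t) →
             ∀ {u} → u ≤ suc (suc (L j)) → OnHole (R d j u)
  R-onHole j c∉ t t∈ = spread (λ u → OnHole (R d j u)) step (s≤s z≤n) (s≤s (s≤s (s≤s⁻¹ (toℕ<n t))))
                         (subst OnHole (sym (R-petal j t)) t∈) z≤n
    where
      step : ∀ v → 0 < v → v < suc (suc (L j)) → OnHole (R d j v) → OnHole (R d j (pred v)) × OnHole (R d j (suc v))
      step v 0<v v< v∈ with position j (<⇒≤ v<)
      ... | start    = ⊥-elim (<-irrefl refl 0<v)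
      ... | inner t′ = petal-neighbours-onHole j t′ (inj₂ c∉) (subst OnHole (R-petal j t′) v∈)
      ... | end      = ⊥-elim (<-irrefl refl v<)

  nbrCount-centre : ∀ j → ¬ OnHole (centreV d j) → ∀ t → OnHole (petal d j t) →
                    nbrCount (daisy d) (centreV d j) m h ≡ 2 + petalNbrs d j
  nbrCount-centre j c∉ t t∈ = trans (nbrCount-≡ (centreV d j) Nbrs Nbrs-unique covers within)
                                    (cong (2 +_) (sym (length-filterᵇ-map (dAdj d (centreV d j)) (petal d j) (allFin (suc (L j))))))
    where
      R∈ : ∀ {u} → u ≤ suc (suc (L j)) → OnHole (R d j u)
      R∈ = R-onHole j c∉ t t∈
      Attached : List (DV d)
      Attached = filterᵇ (dAdj d (centreV d j)) (map (petal d j) (allFin (suc (L j))))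
      Nbrs : List (DV d)
      Nbrs = inj₁ (nx j) ∷ inj₁ (pr j) ∷ Attached
      Attached-petal : ∀ {v} → v ∈ Attached → Σ (Fin (suc (L j))) (λ t → v ≡ petal d j t) × T (dAdj d (centreV d j) v)
      Attached-petal v∈ with ∈-filter⁻ (λ v → T? (dAdj d (centreV d j) v)) {xs = map (petal d j) _} v∈
      ... | v∈ps , cv with ∈-map⁻ (petal d j) v∈ps
      ... | t′ , _ , v≡ = (t′ , v≡) , cv
      not-on-C : ∀ a → All (inj₁ a ≢_) Attached
      not-on-C a = All.tabulate λ v∈ e → case trans e (proj₂ (proj₁ (Attached-petal v∈))) of λ ()
        where open import Function using (case_of_)
      Nbrs-unique : Unique Nbrs
      Nbrs-unique = ((λ e → prev≢next (ce j) (sym (inj₁-injective e))) All.∷ not-on-C (nx j))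
                  ∷ (not-on-C (pr j) ∷ Unique.filter⁺ (λ v → T? (dAdj d (centreV d j) v))
                                                      (Unique.map⁺ petal-injective (Unique.allFin⁺ _)))
        where
          open import Data.Sum.Properties using (inj₁-injective)
          petal-injective : ∀ {t t′} → petal d j t ≡ petal d j t′ → t ≡ t′
          petal-injective refl = refl
      covers : ∀ i → dAdj d (centreV d j) (h i) ≡ true → h i ∈ Nbrs
      covers i e with C-neighbour (ce j) (h i) e
      ... | cycle-next eq          = here eq
      ... | cycle-prev eq          = there (here eq)
      ... | petal-start j′ pr≡ eq  = ⊥-elim (c∉ (subst (λ a → OnHole (inj₁ a)) pr≡ (start-onHole j′ (i , eq))))
      ... | petal-end j′ nx≡ eq    = ⊥-elim (c∉ (subst (λ a → OnHole (inj₁ a)) nx≡ (end-onHole j′ (i , eq))))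
      ... | attachment j′ t′ ce≡ _ eq with centre-injective ce≡
      ...   | refl = there (there (subst (_∈ Attached) (sym eq)
                       (∈-filter⁺ (λ v → T? (dAdj d (centreV d j) v)) (∈-map⁺ (petal d j) (∈-allFin t′))
                                  (≡true⇒T (subst (λ x → dAdj d (centreV d j) x ≡ true) eq e)))))
      within : ∀ {v} → v ∈ Nbrs → OnHole v × dAdj d (centreV d j) v ≡ true
      within (here refl)         = subst OnHole (R-end j) (R∈ ≤-refl) , C.adj-next (ce j)
      within (there (here refl)) = R∈ z≤n , C.adj-prev (ce j)
      within (there (there v∈)) with Attached-petal v∈
      ... | (t′ , refl) , cv = subst OnHole (R-petal j t′) (R∈ (s≤s (m≤n⇒m≤1+n (s≤s⁻¹ (toℕ<n t′))))) , T⇒≡true cv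

  no-even-wheel : (∀ j → Odd (petalNbrs d j)) → ∀ c → 3 ≤ nbrCount (daisy d) c m h → ¬ Even (nbrCount (daisy d) c m h)
  no-even-wheel _ (inj₂ (j , t)) 3≤ even = parity≡true⇒odd 3 refl (subst Even (≤-antisym ≤3 3≤) even)
    where
      ≤3 : nbrCount (daisy d) (petal d j t) m h ≤ 3
      ≤3 = nbrCount-≤ (petal d j t) (R d j (toℕ t) ∷ R d j (suc (suc (toℕ t))) ∷ centreV d j ∷ []) covers
        where
          covers : ∀ i → dAdj d (petal d j t) (h i) ≡ true → h i ∈ (R d j (toℕ t) ∷ R d j (suc (suc (toℕ t))) ∷ centreV d j ∷ [])
          covers i e with petal-neighbour j t (h i) e
          ... | before eq     = here eq
          ... | after eq      = there (here eq)
          ... | attached _ eq = there (there (here eq))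
  no-even-wheel odd (inj₁ a) 3≤ even with onHole? (inj₁ a)
  ... | yes (i , hi≡a) = ≤⇒≯ (≤-reflexive (trans (cong (λ c → nbrCount (daisy d) c m h) (sym hi≡a)) (nbrCount-on-hole i))) 3≤
  ... | no a∉ with any? (λ j → (ce j Fin.≟ a) ×-dec any? (λ t → onHole? (petal d j t)))
  ...   | yes (j , refl , t , t∈) = odd j (∣m+n∣m⇒∣n (subst Even (nbrCount-centre j a∉ t t∈) even) ∣-refl)
  ...   | no no-attachment = ≤⇒≯ ≤2 3≤
    where
      cycle-nbrs : List (DV d)
      cycle-nbrs = inj₁ (nextC d a) ∷ inj₁ (prevC d a) ∷ []
      covers : ∀ i → dAdj d (inj₁ a) (h i) ≡ true → h i ∈ cycle-nbrs
      covers i e with C-neighbour a (h i) e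
      ... | cycle-next eq           = here eq
      ... | cycle-prev eq           = there (here eq)
      ... | petal-start j pr≡ eq    = ⊥-elim (a∉ (subst (λ b → OnHole (inj₁ b)) pr≡ (start-onHole j (i , eq))))
      ... | petal-end j nx≡ eq      = ⊥-elim (a∉ (subst (λ b → OnHole (inj₁ b)) nx≡ (end-onHole j (i , eq))))
      ... | attachment j t ce≡ _ eq = ⊥-elim (no-attachment (j , ce≡ , t , i , eq))
      ≤2 : nbrCount (daisy d) (inj₁ a) m h ≤ 2
      ≤2 = nbrCount-≤ (inj₁ a) cycle-nbrs covers

module PetalHole (d : DaisyData) (j : Fin (l d)) where

  open Daisy d
  private
    module Rest = HoleMinusVertex {daisy d} C-isHole (ce j)

    petalPath : ℕ → DV d
    petalPath v = R d j (suc v)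

    petalPath-petal : ∀ {v} (v≤ : v ≤ L j) → petalPath v ≡ petal d j (fromℕ< (s≤s v≤))
    petalPath-petal v≤ = R-at j (fromℕ< (s≤s v≤)) (toℕ-fromℕ< (s≤s v≤))

    rest≢petal : ∀ u v → u ≤ k d ∸ 2 → v ≤ L j → Rest.path u ≢ petalPath v
    rest≢petal u v _ v≤ e with () ← trans e (petalPath-petal v≤)

    rest-petal-adj : ∀ u v → u ≤ k d ∸ 2 → v ≤ L j →
                     dAdj d (Rest.path u) (petalPath v) ≡ (((u ≡ᵇ k d ∸ 2) ∧ (v ≡ᵇ 0)) ∨ ((u ≡ᵇ 0) ∧ (v ≡ᵇ L j)))
    rest-petal-adj u v u≤ v≤ rewrite petalPath-petal v≤ | toℕ-fromℕ< (s≤s v≤)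
      | Rest.index-vs-prev u≤ | Rest.index-vs-next u≤ | Rest.index-vs-self u≤ =
      cong (((u ≡ᵇ k d ∸ 2) ∧ (v ≡ᵇ 0)) ∨_) (∨-identityʳ _)

    2≤ : 2 ≤ k d ∸ 2 + L j
    2≤ = ≤-trans (2≤n∸2 (4≤k d)) (m≤m+n _ (L j))
      where
        2≤n∸2 : ∀ {n} → 4 ≤ n → 2 ≤ n ∸ 2
        2≤n∸2 (s≤s (s≤s (s≤s (s≤s _)))) = s≤s (s≤s z≤n)

  open Glue {daisy d} dAdj-sym Rest.path-isInducedPath (induced-subpath {daisy d} (R-isInducedPath j) 1 (n≤1+n _))
            rest≢petal rest-petal-adj 2≤ public

  open Hole {daisy d} cycle-isHole using (OnHole)

  length≡ : m ≡ k d + L j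
  length≡ = trans (+-suc (suc (k d ∸ 2)) (L j)) (cong (_+ L j) (2+[n∸2] (4≤k d)))
    where
      2+[n∸2] : ∀ {n} → 4 ≤ n → suc (suc (n ∸ 2)) ≡ n
      2+[n∸2] (s≤s (s≤s (s≤s (s≤s _)))) = refl

  centre∉ : ¬ OnHole (centreV d j)
  centre∉ (i , e) with cycle-onPaths i
  ... | inj₁ (u , u≤ , eq)
    with () ← trans (sym (≡⇒≡ᵇ-true (cong toℕ (inj₁-injective (trans (sym eq) e))))) (Rest.index-vs-self u≤)
  ... | inj₂ (v , v≤ , eq) with () ← trans (sym e) (trans eq (petalPath-petal v≤))

  start∈ : OnHole (petal d j Fin.zero)
  start∈ = Q-onCycle z≤n


evenWheelFree⇒odd-petalNbrs : ∀ d → EvenWheelFree (daisy d) → ∀ j → Odd (petalNbrs d j)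
evenWheelFree⇒odd-petalNbrs d ewf j even = ewf m cycle (centreV d j) ((cycle-isHole , 3≤) , even′)
  where
    open Daisy d using (petalNbrs≥1)
    open PetalHole d j
    count≡ : nbrCount (daisy d) (centreV d j) m cycle ≡ 2 + petalNbrs d j
    count≡ = DaisyHole.nbrCount-centre d cycle-isHole j centre∉ Fin.zero start∈
    3≤ : 3 ≤ nbrCount (daisy d) (centreV d j) m cycle
    3≤ = subst (3 ≤_) (sym count≡) (s≤s (s≤s (petalNbrs≥1 j)))
    even′ : Even (nbrCount (daisy d) (centreV d j) m cycle)
    even′ = subst Even (sym count≡) (∣m∣n⇒∣m+n ∣-refl even)

odd-petalNbrs⇒evenWheelFree : ∀ d → (∀ j → Odd (petalNbrs d j)) → EvenWheelFree (daisy d)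
odd-petalNbrs⇒evenWheelFree d odd m h c ((H , 3≤) , even) = DaisyHole.no-even-wheel d H odd c 3≤ even

-- Even holes

module SectorHole (d : DaisyData) {j a b} (S : IsExtSector d j a b) (2≤ : 2 ≤ b ∸ a) where

  open Daisy d
  private
    module SG = SectorGaps j

    b≤ : b ≤ suc (suc (L j))
    b≤ = proj₁ (sector⇒gap S)

    gap : SG.IsGap a b
    gap = proj₂ (sector⇒gap S)

    a+[b∸a]≡b : a + (b ∸ a) ≡ b
    a+[b∸a]≡b = m+[n∸m]≡n (<⇒≤ (proj₁ gap))

    centrePath : ℕ → DV d
    centrePath _ = centreV d j

    centrePath-induced : IsInducedPath (daisy d) centrePath 0
    centrePath-induced = (λ { _ _ z≤n z≤n → C.adj-self (ce j) }) , (λ { _ _ z≤n z≤n _ → refl })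

    sectorPath-induced : IsInducedPath (daisy d) (λ v → R d j (a + v)) (b ∸ a)
    sectorPath-induced = induced-subpath {daisy d} (R-isInducedPath j) a (≤-trans (≤-reflexive a+[b∸a]≡b) b≤)

    centre≢sector : ∀ u v → u ≤ 0 → v ≤ b ∸ a → centreV d j ≢ R d j (a + v)
    centre≢sector _ v _ v≤ = centre∉R j (≤-trans (≤-trans (+-monoʳ-≤ a v≤) (≤-reflexive a+[b∸a]≡b)) b≤)

    centre-sector-adj : ∀ u v → u ≤ 0 → v ≤ b ∸ a →
                        A j (a + v) ≡ (((u ≡ᵇ 0) ∧ (v ≡ᵇ 0)) ∨ ((u ≡ᵇ 0) ∧ (v ≡ᵇ b ∸ a)))
    centre-sector-adj _ v z≤n v≤ = bool-ext to from
      where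
        to : A j (a + v) ≡ true → ((v ≡ᵇ 0) ∨ (v ≡ᵇ b ∸ a)) ≡ true
        to e with v ≟ 0 | v ≟ b ∸ a
        ... | yes refl | _        = refl
        ... | no _     | yes refl rewrite ≡ᵇ-refl (b ∸ a) = ∨-zeroʳ (b ∸ a ≡ᵇ 0)
        ... | no v≢0   | no v≢q   with () ← trans (sym e) (proj₂ (proj₂ (proj₂ gap)) (a + v)
                                       (subst (a <_) (+-comm v a) (m<n+m a (n≢0⇒n>0 v≢0)))
                                       (subst (a + v <_) a+[b∸a]≡b (+-monoʳ-< a (≤∧≢⇒< v≤ v≢q))))
        from : ((v ≡ᵇ 0) ∨ (v ≡ᵇ b ∸ a)) ≡ true → A j (a + v) ≡ true
        from e with Equivalence.to T-∨ (≡true⇒T e)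
        ... | inj₁ v≡0 rewrite ≡ᵇ⇒≡ v 0 v≡0 | +-identityʳ a = T⇒≡true (proj₁ (proj₂ gap))
        ... | inj₂ v≡q rewrite ≡ᵇ⇒≡ v (b ∸ a) v≡q | a+[b∸a]≡b = T⇒≡true (proj₁ (proj₂ (proj₂ gap)))

  open Glue {daisy d} dAdj-sym centrePath-induced sectorPath-induced centre≢sector centre-sector-adj 2≤ public

evenHoleFree⇒odd-sectors : ∀ d → EvenHoleFree (daisy d) → ∀ j a b → IsExtSector d j a b → Odd (b ∸ a)
evenHoleFree⇒odd-sectors d ehf j a b S even = ehf (2 + (b ∸ a)) cycle cycle-isHole (∣m∣n⇒∣m+n ∣-refl even)
  where
    2≤ : 2 ≤ b ∸ a
    2≤ = positive-even⇒≥2 (m<n⇒0<n∸m (proj₁ S)) even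
      where
        positive-even⇒≥2 : ∀ {n} → 0 < n → Even n → 2 ≤ n
        positive-even⇒≥2 {suc zero}    _ e with () ← even⇒parity≡false 1 e
        positive-even⇒≥2 {suc (suc n)} _ _ = s≤s (s≤s z≤n)
    open SectorHole d S 2≤

module SectorInHole (d : DaisyData) {m : ℕ} {h : Fin m → DV d} (H : IsHole (daisy d) m h) where

  open Daisy d
  open Hole {daisy d} H
  open HoleCount {daisy d} _≟V_ H
  open DaisyHole d H

  private
    nonattached-onHole : ∀ j t → OnHole (petal d j t) →
                         Σ ℕ λ u → u ≤ suc (suc (L j)) × A j u ≡ false × OnHole (R d j u)
    nonattached-onHole j t (i , hi≡) with att d j t in subst-adj
    ... | false = suc (toℕ t) , s≤s (m≤n⇒m≤1+n (s≤s⁻¹ (toℕ<n t))) , trans (A-petal j t) subst-adj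
                , subst OnHole (sym (R-petal j t)) (i , hi≡)
    ... | true with one-of-two-on-hole i (R d j (toℕ t)) (R d j (suc (suc (toℕ t)))) (centreV d j) along
      where
        along : ∀ i′ → dAdj d (h i) (h i′) ≡ true →
                h i′ ≡ R d j (toℕ t) ⊎ h i′ ≡ R d j (suc (suc (toℕ t))) ⊎ h i′ ≡ centreV d j
        along i′ e with petal-neighbour j t (h i′) (subst (λ x → dAdj d x (h i′) ≡ true) hi≡ e)
        ... | before eq     = inj₁ eq
        ... | after eq      = inj₂ (inj₁ eq)
        ... | attached _ eq = inj₂ (inj₂ eq)
    ...   | inj₁ before∈ = toℕ t , m≤n⇒m≤1+n (m≤n⇒m≤1+n (s≤s⁻¹ (toℕ<n t))) , A-before-attachment j t subst-adj , before∈
    ...   | inj₂ after∈  = suc (suc (toℕ t)) , s≤s (s≤s (s≤s⁻¹ (toℕ<n t))) , A-after-attachment j t subst-adj , after∈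

  module _ (j : Fin (l d)) where

    private module SG = SectorGaps j

    record SectorOnHole : Set where
      field
        a b     : ℕ
        gap     : SG.IsGap a b
        b≤      : b ≤ suc (suc (L j))
        inside∈ : ∀ {z} → a ≤ z → z ≤ b → OnHole (R d j z)

    sector-onHole : ∀ t → OnHole (petal d j t) → SectorOnHole
    sector-onHole t t∈ with nonattached-onHole j t t∈
    ... | u , u≤ , Au , u∈ with SG.gap-around (A-end j) u≤ Au
    ...   | a , b , gap , a<u , u<b , b≤ = record { a = a ; b = b ; gap = gap ; b≤ = b≤ ; inside∈ = spread P step a<u u<b u∈ }
      where
        P : ℕ → Set
        P z = OnHole (R d j z)
        step : ∀ v → a < v → v < b → P v → P (pred v) × P (suc v)
        step v a<v v<b v∈ with position j (≤-trans (<⇒≤ v<b) b≤)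
        ... | start    = ⊥-elim (n≮0 a<v)
        ... | inner t′ = petal-neighbours-onHole j t′ (inj₁ (trans (sym (A-petal j t′)) (proj₂ (proj₂ (proj₂ gap)) _ a<v v<b)))
                           (subst OnHole (R-petal j t′) v∈)
        ... | end      = ⊥-elim (<⇒≱ v<b b≤)

    module _ (c∈ : OnHole (centreV d j)) (S : SectorOnHole) where

      open SectorOnHole S

      InSector : DV d → Set
      InSector v = v ≡ centreV d j ⊎ Σ ℕ λ z → a ≤ z × z ≤ b × v ≡ R d j z

      private
        a<b : a < b
        a<b = proj₁ gap

        ≤b⇒≤N : ∀ {z} → z ≤ b → z ≤ suc (suc (L j))
        ≤b⇒≤N z≤b = ≤-trans z≤b b≤

        predecessor : ∀ {z} → a < z → Σ ℕ λ z′ → z ≡ suc z′ × a ≤ z′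
        predecessor {suc z′} (s≤s a≤z′) = z′ , refl , a≤z′

        R-onSector : ∀ {z} → a ≤ z → z ≤ b → InSector (R d j z)
        R-onSector a≤z z≤b = inj₂ (_ , a≤z , z≤b , refl)

        R≢R : ∀ {u v} → u ≤ b → v ≤ b → u ≢ v → R d j u ≢ R d j v
        R≢R u≤b v≤b u≢v e = u≢v (R-injective j (≤b⇒≤N u≤b) (≤b⇒≤N v≤b) e)

        R-adjacent-centre : ∀ {z} → z ≤ b → A j z ≡ true → dAdj d (R d j z) (centreV d j) ≡ true
        R-adjacent-centre {z} _ Az = trans (dAdj-sym (R d j z) (centreV d j)) Az

        R-adjacent-back : ∀ {z} → suc z ≤ b → dAdj d (R d j (suc z)) (R d j z) ≡ true
        R-adjacent-back {z} z<b = trans (dAdj-sym (R d j (suc z)) (R d j z)) (R-adjacent j (≤b⇒≤N z<b))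

        via-two : ∀ i {v₁ v₂} → OnHole v₁ → OnHole v₂ → InSector v₁ → InSector v₂ → v₁ ≢ v₂ →
                  dAdj d (h i) v₁ ≡ true → dAdj d (h i) v₂ ≡ true → InSector (h (next i))
        via-two i (i₁ , refl) (i₂ , refl) X₁ X₂ v₁≢v₂ e₁ e₂ with next-one-of i e₁ e₂ (λ eq → v₁≢v₂ (cong h eq))
        ... | inj₁ refl = X₁
        ... | inj₂ refl = X₂

        subst-adj : ∀ {i v w} → h i ≡ v → dAdj d v w ≡ true → dAdj d (h i) w ≡ true
        subst-adj refl e = e

        closed : ∀ i → InSector (h i) → InSector (h (next i))
        closed i (inj₁ hi≡c) =
          via-two i (inside∈ ≤-refl (<⇒≤ a<b)) (inside∈ (<⇒≤ a<b) ≤-refl) (R-onSector ≤-refl (<⇒≤ a<b)) (R-onSector (<⇒≤ a<b) ≤-refl)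
                  (R≢R (<⇒≤ a<b) ≤-refl (<⇒≢ a<b))
                  (subst-adj hi≡c (T⇒≡true (proj₁ (proj₂ gap)))) (subst-adj hi≡c (T⇒≡true (proj₁ (proj₂ (proj₂ gap)))))
        closed i (inj₂ (z , a≤z , z≤b , hi≡)) with m≤n⇒m<n∨m≡n a≤z | m≤n⇒m<n∨m≡n z≤b
        ... | inj₂ refl | _ =
          via-two i c∈ (inside∈ (n≤1+n a) a<b) (inj₁ refl) (R-onSector (n≤1+n a) a<b)
                  (centre∉R j (≤b⇒≤N a<b)) (subst-adj hi≡ (R-adjacent-centre z≤b (T⇒≡true (proj₁ (proj₂ gap)))))
                  (subst-adj hi≡ (R-adjacent j (≤b⇒≤N a<b)))
        ... | inj₁ a<z | inj₂ refl with predecessor a<z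
        ...   | b′ , refl , a≤b′ =
          via-two i c∈ (inside∈ a≤b′ (n≤1+n b′)) (inj₁ refl) (R-onSector a≤b′ (n≤1+n b′))
                  (centre∉R j (≤b⇒≤N (n≤1+n b′))) (subst-adj hi≡ (R-adjacent-centre z≤b (T⇒≡true (proj₁ (proj₂ (proj₂ gap))))))
                  (subst-adj hi≡ (R-adjacent-back z≤b))
        closed i (inj₂ (z , a≤z , z≤b , hi≡)) | inj₁ a<z | inj₁ z<b with predecessor a<z
        ...   | z′ , refl , a≤z′ =
          via-two i (inside∈ a≤z′ (≤-trans (n≤1+n z′) z≤b)) (inside∈ (m≤n⇒m≤1+n a≤z) z<b)
                  (R-onSector a≤z′ (≤-trans (n≤1+n z′) z≤b)) (R-onSector (m≤n⇒m≤1+n a≤z) z<b)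
                  (R≢R (≤-trans (n≤1+n z′) z≤b) z<b (λ e → <⇒≢ (≤-trans (n<1+n z′) (n≤1+n _)) e))
                  (subst-adj hi≡ (R-adjacent-back z≤b)) (subst-adj hi≡ (R-adjacent j (≤b⇒≤N z<b)))

      inSector : ∀ i → InSector (h i)
      inSector = next-induction (λ i → InSector (h i)) {proj₁ c∈} (inj₁ (proj₂ c∈)) closed

      length≡ : m ≡ 2 + (b ∸ a)
      length≡ = trans (m≡length Vs Vs-unique covers within) (cong suc (length-applyUpTo vertex (suc (b ∸ a))))
        where
          a+[b∸a]≡b : a + (b ∸ a) ≡ b
          a+[b∸a]≡b = m+[n∸m]≡n (<⇒≤ a<b)
          ≤b∸a⇒≤b : ∀ {w} → w ≤ b ∸ a → a + w ≤ b
          ≤b∸a⇒≤b w≤ = ≤-trans (+-monoʳ-≤ a w≤) (≤-reflexive a+[b∸a]≡b)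
          vertex : ℕ → DV d
          vertex w = R d j (a + w)
          Vs : List (DV d)
          Vs = centreV d j ∷ applyUpTo vertex (suc (b ∸ a))
          Vs-unique : Unique Vs
          Vs-unique = All.tabulate centre∉
                    ∷ Unique.applyUpTo⁺₁ vertex (suc (b ∸ a))
                        (λ {w} {w′} w<w′ w′< e → <⇒≢ w<w′ (+-cancelˡ-≡ a w w′
                           (R-injective j (≤b⇒≤N (≤b∸a⇒≤b (≤-trans (<⇒≤ w<w′) (s≤s⁻¹ w′<)))) (≤b⇒≤N (≤b∸a⇒≤b (s≤s⁻¹ w′<))) e)))
            where
              centre∉ : ∀ {v} → v ∈ applyUpTo vertex (suc (b ∸ a)) → centreV d j ≢ v
              centre∉ v∈ with ∈-applyUpTo⁻ vertex v∈
              ... | w , w< , refl = centre∉R j (≤b⇒≤N (≤b∸a⇒≤b (s≤s⁻¹ w<)))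
          covers : ∀ i → h i ∈ Vs
          covers i with inSector i
          ... | inj₁ hi≡c = here hi≡c
          ... | inj₂ (z , a≤z , z≤b , hi≡) =
            there (subst (_∈ applyUpTo vertex (suc (b ∸ a))) (trans (cong (R d j) (m+[n∸m]≡n a≤z)) (sym hi≡))
                         (∈-applyUpTo⁺ vertex (s≤s (∸-monoˡ-≤ a z≤b))))
          within : ∀ {v} → v ∈ Vs → OnHole v
          within (here refl) = c∈
          within (there v∈) with ∈-applyUpTo⁻ vertex v∈
          ... | w , w< , refl = inside∈ (m≤m+n a w) (≤b∸a⇒≤b (s≤s⁻¹ w<))

module HoleAroundC (d : DaisyData) {m : ℕ} {h : Fin m → DV d} (H : IsHole (daisy d) m h)
                   (avoids : ∀ j → Hole.OnHole {daisy d} H (centreV d j) →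
                             ∀ t → ¬ Hole.OnHole {daisy d} H (petal d j t)) where

  open Daisy d
  open Hole {daisy d} H
  open HoleCount {daisy d} _≟V_ H
  open DaisyHole d H

  Used : Fin (l d) → Set
  Used j = Σ (Fin (suc (L j))) λ t → OnHole (petal d j t)

  used? : ∀ j → Dec (Used j)
  used? j = any? (λ t → onHole? (petal d j t))

  used⇒R∈ : ∀ {j} → Used j → ∀ {u} → u ≤ suc (suc (L j)) → OnHole (R d j u)
  used⇒R∈ {j} (t , t∈) = R-onHole j (λ c∈ → avoids j c∈ t t∈) t t∈

  UsedCentre : Fin (k d) → Set
  UsedCentre a = Σ (Fin (l d)) λ j → Used j × ce j ≡ a

  private
    Covered : Fin (k d) → Set
    Covered a = OnHole (inj₁ a) ⊎ UsedCentre a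

    -- Only one hole-neighbour of a ∈ C can lie on its left (prev a, or the end
    -- of a petal centred at prev a), so the other one shows that next a is covered.
    data Side (a : Fin (k d)) (w : DV d) : Set where
      left-cycle : w ≡ inj₁ (prevC d a) → Side a w
      left-petal : ∀ j → nx j ≡ a → w ≡ R d j (suc (L j)) → Side a w
      right      : Covered (nextC d a) → Side a w

    side : ∀ {a w} → OnHole (inj₁ a) → OnHole w → dAdj d (inj₁ a) w ≡ true → Side a w
    side {a} {w} a∈ w∈ e with C-neighbour a w e
    ... | cycle-next eq          = right (inj₁ (subst OnHole eq w∈))
    ... | cycle-prev eq          = left-cycle eq
    ... | petal-start j pr≡a eq  = right (inj₂ (j , (Fin.zero , subst OnHole eq w∈)
                                                 , trans (sym (C.next-prev (ce j))) (cong (nextC d) pr≡a)))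
    ... | petal-end j nx≡a eq    = left-petal j nx≡a eq
    ... | attachment j t refl _ eq = ⊥-elim (avoids j a∈ t (subst OnHole eq w∈))

    prev-and-last-onHole : ∀ {a} j → nx j ≡ a → OnHole (inj₁ (prevC d a)) → ¬ OnHole (R d j (suc (L j)))
    prev-and-last-onHole j nx≡a prev∈ y∈ =
      avoids j (subst (λ b → OnHole (inj₁ b)) (trans (cong (prevC d) (sym nx≡a)) (C.prev-next (ce j))) prev∈)
            (fromℕ (L j)) (subst OnHole (R-last j) y∈)

    left-unique : ∀ {a w₁ w₂} → OnHole w₁ → OnHole w₂ → Side a w₁ → Side a w₂ →
                  w₁ ≡ w₂ ⊎ Covered (nextC d a)
    left-unique _ _ (right c) _ = inj₂ c
    left-unique _ _ _ (right c) = inj₂ c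
    left-unique _ _ (left-cycle refl) (left-cycle refl) = inj₁ refl
    left-unique w₁∈ w₂∈ (left-cycle refl) (left-petal j nx≡a refl) = ⊥-elim (prev-and-last-onHole j nx≡a w₁∈ w₂∈)
    left-unique w₁∈ w₂∈ (left-petal j nx≡a refl) (left-cycle refl) = ⊥-elim (prev-and-last-onHole j nx≡a w₂∈ w₁∈)
    left-unique _ _ (left-petal j nx≡a refl) (left-petal j′ nx≡a′ refl) with centre-injective
      (trans (sym (C.prev-next (ce j))) (trans (cong (prevC d) (trans nx≡a (sym nx≡a′))) (C.prev-next (ce j′))))
    ... | refl = inj₁ refl

    covered-next : ∀ a → Covered a → Covered (nextC d a)
    covered-next a (inj₂ (j , used , refl)) = inj₁ (subst OnHole (R-end j) (used⇒R∈ used ≤-refl))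
    covered-next a (inj₁ (i , hi≡a)) with left-unique (next i , refl) (prev i , refl)
                                            (side (i , hi≡a) (next i , refl) (on-i (adj-next i)))
                                            (side (i , hi≡a) (prev i , refl) (on-i (adj-prev i)))
      where
        on-i : ∀ {w} → dAdj d (h i) w ≡ true → dAdj d (inj₁ a) w ≡ true
        on-i = subst (λ x → dAdj d x _ ≡ true) hi≡a
    ... | inj₁ same = ⊥-elim (next≢prev i (h-injective same))
    ... | inj₂ c    = c

  covered : ∀ a → OnHole (inj₁ a) ⊎ UsedCentre a
  covered = C.next-induction Covered (proj₂ initial) covered-next
    where
      i₀ : Fin m
      i₀ = fromℕ< (≤-trans (s≤s z≤n) 4≤m)
      initial : Σ (Fin (k d)) Covered
      initial with h i₀ in hi₀≡
      ... | inj₁ a       = a , inj₁ (i₀ , hi₀≡)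
      ... | inj₂ (j , t) = ce j , inj₂ (j , (t , i₀ , hi₀≡) , refl)

  private
    petalVertices : Fin (l d) → List (DV d)
    petalVertices j = map (petal d j) (allFin (suc (L j)))

    UsedVertices : List (Fin (l d)) → List (DV d)
    UsedVertices []       = []
    UsedVertices (j ∷ js) with used? j
    ... | yes _ = petalVertices j ++ UsedVertices js
    ... | no  _ = UsedVertices js

    ∈UsedVertices⁻ : ∀ js {v} → v ∈ UsedVertices js →
                     Σ (Fin (l d)) λ j → j ∈ js × Used j × Σ (Fin (suc (L j))) λ t → v ≡ petal d j t
    ∈UsedVertices⁻ (j ∷ js) v∈ with used? j
    ... | no _ = let j′ , j′∈ , rest = ∈UsedVertices⁻ js v∈ in j′ , there j′∈ , rest
    ... | yes used with ∈-++⁻ (petalVertices j) v∈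
    ...   | inj₁ v∈j  = let t , _ , v≡ = ∈-map⁻ (petal d j) v∈j in j , here refl , used , t , v≡
    ...   | inj₂ v∈js = let j′ , j′∈ , rest = ∈UsedVertices⁻ js v∈js in j′ , there j′∈ , rest

    ∈UsedVertices⁺ : ∀ js {j} → j ∈ js → Used j → ∀ t → petal d j t ∈ UsedVertices js
    ∈UsedVertices⁺ (j ∷ js) (here refl) used t with used? j
    ... | yes _     = ∈-++⁺ˡ (∈-map⁺ (petal d j) (∈-allFin t))
    ... | no unused = ⊥-elim (unused used)
    ∈UsedVertices⁺ (j′ ∷ js) (there j∈) used t with used? j′
    ... | yes _ = ∈-++⁺ʳ (petalVertices j′) (∈UsedVertices⁺ js j∈ used t)
    ... | no  _ = ∈UsedVertices⁺ js j∈ used t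

    UsedVertices-unique : ∀ js → Unique js → Unique (UsedVertices js)
    UsedVertices-unique []       _          = []
    UsedVertices-unique (j ∷ js) (j∉ ∷ js!) with used? j
    ... | no  _ = UsedVertices-unique js js!
    ... | yes _ = Unique.++⁺ (Unique.map⁺ petal-injective (Unique.allFin⁺ _)) (UsedVertices-unique js js!) disjoint
      where
        petal-injective : ∀ {t t′} → petal d j t ≡ petal d j t′ → t ≡ t′
        petal-injective refl = refl
        disjoint : ∀ {v} → ¬ (v ∈ petalVertices j × v ∈ UsedVertices js)
        disjoint (v∈₁ , v∈₂) with ∈-map⁻ (petal d j) v∈₁ | ∈UsedVertices⁻ js v∈₂
        ... | _ , _ , refl | j′ , j′∈ , _ , _ , refl = All.lookup j∉ j′∈ refl

    parity-UsedVertices : (∀ j → parity (L j) ≡ false) → ∀ js →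
                          parity (length (UsedVertices js)) ≡ parity (length (filter used? js))
    parity-UsedVertices even-L []       = refl
    parity-UsedVertices even-L (j ∷ js) with used? j
    ... | no  unused = trans (parity-UsedVertices even-L js)
                             (cong (λ js′ → parity (length js′)) (sym (filter-reject used? {xs = js} unused)))
    ... | yes used = begin
      parity (length (petalVertices j ++ UsedVertices js))                  ≡⟨ cong parity (length-++ (petalVertices j)) ⟩
      parity (length (petalVertices j) + length (UsedVertices js))          ≡⟨ parity-+ (length (petalVertices j)) _ ⟩
      parity (length (petalVertices j)) xor parity (length (UsedVertices js))
        ≡⟨ cong₂ _xor_ parity-petal (parity-UsedVertices even-L js) ⟩
      true xor parity (length (filter used? js))
        ≡⟨ cong (λ js′ → parity (length js′)) (filter-accept used? {xs = js} used) ⟨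
      parity (length (filter used? (j ∷ js)))                               ∎
      where
        open ≡-Reasoning
        parity-petal : parity (length (petalVertices j)) ≡ true
        parity-petal = begin
          parity (length (petalVertices j))
            ≡⟨ cong parity (trans (length-map (petal d j) (allFin _)) (length-tabulate {n = suc (L j)} (λ t → t))) ⟩
          not (parity (L j))                ≡⟨ cong not (even-L j) ⟩
          true                              ∎

    C-on C-off : List (Fin (k d))
    C-on  = filter (λ a → onHole? (inj₁ a)) (allFin (k d))
    C-off = filter (λ a → ¬? (onHole? (inj₁ a))) (allFin (k d))

    |C-off|≡|used| : length C-off ≡ length (filter used? (allFin (l d)))
    |C-off|≡|used| = sym (trans (sym (length-map ce (filter used? (allFin (l d)))))
                               (unique-⊆-⊇⇒length-≡ centres-unique C-off-unique centres⊆ ⊆centres))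
      where
        centres-unique : Unique (map ce (filter used? (allFin (l d))))
        centres-unique = Unique.map⁺ centre-injective (Unique.filter⁺ used? (Unique.allFin⁺ _))
        C-off-unique : Unique C-off
        C-off-unique = Unique.filter⁺ (λ a → ¬? (onHole? (inj₁ a))) (Unique.allFin⁺ _)
        centres⊆ : ∀ {a} → a ∈ map ce (filter used? (allFin (l d))) → a ∈ C-off
        centres⊆ a∈ with ∈-map⁻ ce a∈
        ... | j , j∈ , refl = ∈-filter⁺ (λ a → ¬? (onHole? (inj₁ a))) (∈-allFin _)
                                (λ c∈ → let t , t∈ = proj₂ (∈-filter⁻ used? {xs = allFin _} j∈) in avoids j c∈ t t∈)
        ⊆centres : ∀ {a} → a ∈ C-off → a ∈ map ce (filter used? (allFin (l d)))
        ⊆centres {a} a∈ with covered a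
        ... | inj₁ a-on = ⊥-elim (proj₂ (∈-filter⁻ (λ a → ¬? (onHole? (inj₁ a))) {xs = allFin _} a∈) a-on)
        ... | inj₂ (j , used , refl) = ∈-map⁺ ce (∈-filter⁺ used? (∈-allFin j) used)

    vertices : List (DV d)
    vertices = map inj₁ C-on ++ UsedVertices (allFin (l d))

    m≡|vertices| : m ≡ length vertices
    m≡|vertices| = m≡length vertices vertices-unique covers within
      where
        vertices-unique : Unique vertices
        vertices-unique = Unique.++⁺ (Unique.map⁺ inj₁-injective (Unique.filter⁺ (λ a → onHole? (inj₁ a)) (Unique.allFin⁺ _)))
                                     (UsedVertices-unique (allFin (l d)) (Unique.allFin⁺ _)) disjoint
          where
            disjoint : ∀ {v} → ¬ (v ∈ map inj₁ C-on × v ∈ UsedVertices (allFin (l d)))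
            disjoint (v∈₁ , v∈₂) with ∈-map⁻ inj₁ v∈₁ | ∈UsedVertices⁻ (allFin (l d)) v∈₂
            ... | _ , _ , refl | _ , _ , _ , _ , ()
        covers : ∀ i → h i ∈ vertices
        covers i with h i in hi≡
        ... | inj₁ a       = ∈-++⁺ˡ (∈-map⁺ inj₁ (∈-filter⁺ (λ a → onHole? (inj₁ a)) (∈-allFin a) (i , hi≡)))
        ... | inj₂ (j , t) = ∈-++⁺ʳ (map inj₁ C-on) (∈UsedVertices⁺ (allFin (l d)) (∈-allFin j) (t , i , hi≡) t)
        within : ∀ {v} → v ∈ vertices → OnHole v
        within v∈ with ∈-++⁻ (map inj₁ C-on) v∈
        ... | inj₁ v∈C with ∈-map⁻ inj₁ v∈C
        ...   | a , a∈ , refl = proj₂ (∈-filter⁻ (λ a → onHole? (inj₁ a)) {xs = allFin _} a∈)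
        within v∈ | inj₂ v∈P with ∈UsedVertices⁻ (allFin (l d)) v∈P
        ...   | j , _ , used , t , refl = subst OnHole (R-petal j t) (used⇒R∈ used (s≤s (m≤n⇒m≤1+n (s≤s⁻¹ (toℕ<n t)))))

  -- The hole consists of its vertices on C and of the used petals in full, and
  -- the vertices of C off the hole are exactly the centres of the used petals.
  parity-length : (∀ j → parity (L j) ≡ false) → parity m ≡ parity (k d)
  parity-length even-L = begin
    parity m                                                        ≡⟨ cong parity m≡|vertices| ⟩
    parity (length vertices)                                        ≡⟨ cong parity (length-++ (map inj₁ C-on)) ⟩
    parity (length (map inj₁ C-on) + length (UsedVertices (allFin (l d)))) ≡⟨ parity-+ (length (map inj₁ C-on)) _ ⟩
    parity (length (map inj₁ C-on)) xor parity (length (UsedVertices (allFin (l d))))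
      ≡⟨ cong₂ _xor_ (cong parity (length-map inj₁ C-on)) (parity-UsedVertices even-L (allFin (l d))) ⟩
    parity (length C-on) xor parity (length (filter used? (allFin (l d))))
      ≡⟨ cong (λ n → parity (length C-on) xor parity n) |C-off|≡|used| ⟨
    parity (length C-on) xor parity (length C-off)                  ≡⟨ parity-+ (length C-on) (length C-off) ⟨
    parity (length C-on + length C-off)
      ≡⟨ cong parity (length-filter+length-filter-∁ (λ a → onHole? (inj₁ a)) (allFin (k d))) ⟩
    parity (length (allFin (k d)))                                  ≡⟨ cong parity (length-tabulate {n = k d} (λ a → a)) ⟩
    parity (k d)                                                    ∎
    where open ≡-Reasoning

evenHoleFree⇒odd-petalNbrs : ∀ d → EvenHoleFree (daisy d) → ∀ j → Odd (petalNbrs d j)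
evenHoleFree⇒odd-petalNbrs d ehf j even-p = ehf m cycle cycle-isHole (parity≡false⇒even m (begin
  parity m                                   ≡⟨ cong parity length≡ ⟩
  parity (k d + L j)                         ≡⟨ parity-+ (k d) (L j) ⟩
  parity (k d) xor parity (L j)              ≡⟨ cong₂ _xor_ (odd⇒parity≡true (k d) odd-k) (odd-sectors⇒parity-len j odd-sectors) ⟩
  true xor not (parity (petalNbrs d j))      ≡⟨ cong (λ b → true xor not b) (even⇒parity≡false _ even-p) ⟩
  false                                      ∎))
  where
    open ≡-Reasoning
    open Daisy d using (L; C-isHole; odd-sectors⇒parity-len)
    open PetalHole d j
    odd-k : Odd (k d)
    odd-k = ehf (k d) inj₁ C-isHole
    odd-sectors : ∀ a b → IsExtSector d j a b → Odd (b ∸ a)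
    odd-sectors = evenHoleFree⇒odd-sectors d ehf j

conditions⇒evenHoleFree : ∀ d → EvenWheelFree (daisy d) → Odd (k d) →
                          (∀ j a b → IsExtSector d j a b → Odd (b ∸ a)) → EvenHoleFree (daisy d)
conditions⇒evenHoleFree d ewf odd-k odd-sectors m h H even-m
  with any? (λ j → DaisyHole.onHole? d H (centreV d j) ×-dec any? (λ t → DaisyHole.onHole? d H (petal d j t)))
... | yes (j , c∈ , t , t∈) =
  odd-sectors j a b (gap⇒sector b≤ gap) (∣m+n∣m⇒∣n (subst Even (length≡ j c∈ S) even-m) ∣-refl)
  where
    open Daisy d using (gap⇒sector)
    open SectorInHole d H
    S : SectorOnHole j
    S = sector-onHole j t t∈
    open SectorOnHole S
... | no no-sector =
  parity≡true⇒odd m (trans (parity-length even-len) (odd⇒parity≡true (k d) odd-k)) even-m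
  where
    open Daisy d using (L; odd-sectors⇒parity-len)
    open HoleAroundC d H (λ j c∈ t t∈ → no-sector (j , c∈ , t , t∈))
    even-len : ∀ j → parity (L j) ≡ false
    even-len j = trans (odd-sectors⇒parity-len j (odd-sectors j))
                       (cong not (odd⇒parity≡true _ (evenWheelFree⇒odd-petalNbrs d ewf j)))

-- Bipartiteness

module Colouring (d : DaisyData) (even-k : Even (k d))
                 (even-sectors : ∀ j a b → IsExtSector d j a b → Even (b ∸ a)) where

  open Daisy d

  colour : DV d → Bool
  colour (inj₁ a)       = parity (toℕ a)
  colour (inj₂ (j , t)) = parity (toℕ (pr j) + suc (toℕ t))

  private
    differ : ∀ {x y} → y ≡ not x → x ≢ y
    differ {x} refl = not-¬ refl

    xor-true : ∀ x → x xor true ≡ not x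
    xor-true x = xor-comm x true

    parity-next : ∀ a → parity (toℕ (nextC d a)) ≡ not (parity (toℕ a))
    parity-next a = begin
      parity (toℕ (nextC d a))    ≡⟨ cong parity (C.toℕ-next a) ⟩
      parity ((toℕ a + 1) % k d)  ≡⟨ parity-%-even (toℕ a + 1) (k d) even-k ⟩
      parity (toℕ a + 1)          ≡⟨ parity-+ (toℕ a) 1 ⟩
      parity (toℕ a) xor true     ≡⟨ xor-true (parity (toℕ a)) ⟩
      not (parity (toℕ a))        ∎
      where open ≡-Reasoning

    parity-prev : ∀ a → parity (toℕ (prevC d a)) ≡ not (parity (toℕ a))
    parity-prev a = begin
      parity (toℕ (prevC d a))                ≡⟨ not-involutive _ ⟨
      not (not (parity (toℕ (prevC d a))))    ≡⟨ cong not (parity-next (prevC d a)) ⟨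
      not (parity (toℕ (nextC d (prevC d a)))) ≡⟨ cong (λ x → not (parity (toℕ x))) (C.next-prev a) ⟩
      not (parity (toℕ a))                    ∎
      where open ≡-Reasoning

    parity-centre : ∀ j → parity (toℕ (ce j)) ≡ not (parity (toℕ (pr j)))
    parity-centre j = trans (cong (λ a → parity (toℕ a)) (sym (C.next-prev (ce j)))) (parity-next (pr j))

    parity-petal : ∀ j t → colour (petal d j t) ≡ parity (toℕ (pr j)) xor parity (suc (toℕ t))
    parity-petal j t = parity-+ (toℕ (pr j)) (suc (toℕ t))

    successive-petal : ∀ {j} {t t′ : Fin (suc (L j))} → suc (toℕ t) ≡ toℕ t′ →
                       colour (petal d j t′) ≡ not (colour (petal d j t))
    successive-petal {j} {t} e = trans (cong (λ n → parity (toℕ (pr j) + suc n)) (sym e))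
                                       (cong parity (+-suc (toℕ (pr j)) (suc (toℕ t))))

    cp-proper : ∀ a j t → dAdj d (inj₁ a) (petal d j t) ≡ true → colour (inj₁ a) ≢ colour (petal d j t)
    cp-proper a j t e with cp-edge a j t e
    ... | at-start refl t≡0 = differ (begin
      colour (petal d j t)                           ≡⟨ parity-petal j t ⟩
      parity (toℕ (pr j)) xor parity (suc (toℕ t))   ≡⟨ cong (λ n → parity (toℕ (pr j)) xor parity (suc n)) t≡0 ⟩
      parity (toℕ (pr j)) xor true                   ≡⟨ xor-true _ ⟩
      not (parity (toℕ (pr j)))                      ∎)
      where open ≡-Reasoning
    ... | at-end refl t≡L = differ (begin
      colour (petal d j t)                           ≡⟨ parity-petal j t ⟩
      parity (toℕ (pr j)) xor parity (suc (toℕ t))   ≡⟨ cong (λ n → parity (toℕ (pr j)) xor not (parity n)) t≡L ⟩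
      parity (toℕ (pr j)) xor not (parity (L j))
        ≡⟨ cong (λ b → parity (toℕ (pr j)) xor not b) (even-sectors⇒parity-len j (even-sectors j)) ⟩
      parity (toℕ (pr j)) xor true                   ≡⟨ xor-true _ ⟩
      not (parity (toℕ (pr j)))                      ≡⟨ cong not (trans (sym (not-involutive _)) (cong not (sym (parity-centre j)))) ⟩
      not (not (parity (toℕ (ce j))))                ≡⟨ cong not (sym (parity-next (ce j))) ⟩
      not (parity (toℕ (nx j)))                      ∎)
      where open ≡-Reasoning
    ... | at-centre refl at = λ e′ → differ (begin
      colour (inj₁ (ce j))                           ≡⟨ parity-centre j ⟩
      not (parity (toℕ (pr j)))                      ≡⟨ cong not (xor-identityʳ _) ⟨
      not (parity (toℕ (pr j)) xor false)
        ≡⟨ cong (λ b → not (parity (toℕ (pr j)) xor b)) (even-sectors⇒parity-attachment j (even-sectors j) t at) ⟨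
      not (parity (toℕ (pr j)) xor parity (suc (toℕ t))) ≡⟨ cong not (parity-petal j t) ⟨
      not (colour (petal d j t))                     ∎) (sym e′)
      where open ≡-Reasoning

  proper : ∀ u v → T (dAdj d u v) → colour u ≢ colour v
  proper (inj₁ a) (inj₁ b) uv with C.adj⇒next⊎prev a b (T⇒≡true uv)
  ... | inj₁ refl = differ (parity-next a)
  ... | inj₂ refl = differ (parity-prev a)
  proper (inj₁ a) (inj₂ (j , t)) uv = cp-proper a j t (T⇒≡true uv)
  proper (inj₂ (j , t)) (inj₁ a) uv = λ e → cp-proper a j t (T⇒≡true uv) (sym e)
  proper (inj₂ (j , t)) (inj₂ (j′ , t′)) uv with Equivalence.to T-∧ uv
  ... | j≡j′ , t~t′ with toℕ-injective (≡ᵇ⇒≡ (toℕ j) (toℕ j′) j≡j′)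
  ... | refl with Equivalence.to T-∨ t~t′
  ... | inj₁ t+1≡t′ = differ (successive-petal (≡ᵇ⇒≡ _ _ t+1≡t′))
  ... | inj₂ t′+1≡t = λ e → differ (successive-petal (≡ᵇ⇒≡ _ _ t′+1≡t)) (sym e)

  bipartite : Bipartite (daisy d)
  bipartite = colour , proper

bipartite⇒even-sectors : ∀ d → Bipartite (daisy d) → ∀ j a b → IsExtSector d j a b → Even (b ∸ a)
bipartite⇒even-sectors d B j a b S with 2 ≤? b ∸ a
... | yes 2≤ = ∣m+n∣m⇒∣n (bipartite⇒even-hole B cycle-isHole) ∣-refl
  where open SectorHole d S 2≤
... | no 2≰ = ⊥-elim (bipartite⇒no-triangle {daisy d} B {centreV d j} {R d j a} {R d j b} A-a R-adjacent-b A-b)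
  where
    open Daisy d
    a<b : a < b
    a<b = proj₁ S
    b≡1+a : b ≡ suc a
    b≡1+a = trans (sym (m+[n∸m]≡n (<⇒≤ a<b)))
                  (trans (cong (a +_) (≤-antisym (s≤s⁻¹ (≰⇒> 2≰)) (m<n⇒0<n∸m a<b))) (+-comm a 1))
    A-a : T (dAdj d (centreV d j) (R d j a))
    A-a = proj₁ (proj₂ (proj₂ S))
    A-b : T (dAdj d (centreV d j) (R d j b))
    A-b = proj₁ (proj₂ (proj₂ (proj₂ S)))
    R-adjacent-b : T (dAdj d (R d j a) (R d j b))
    R-adjacent-b = ≡true⇒T (subst (λ u → dAdj d (R d j a) (R d j u) ≡ true) (sym b≡1+a)
                              (R-adjacent j (subst (_≤ suc (suc (L j))) b≡1+a (proj₁ (sector⇒gap S)))))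

lemmal : (d : DaisyData) →
    (EvenWheelFree (daisy d) ⇔ (∀ j → Odd (petalNbrs d j)))
    × (EvenHoleFree (daisy d) ⇔
        (EvenWheelFree (daisy d) × Odd (k d)
         × (∀ j a b → IsExtSector d j a b → Odd (b ∸ a))))
    × (Bipartite (daisy d) ⇔
        (Even (k d) × (∀ j a b → IsExtSector d j a b → Even (b ∸ a))))
lemmal d =
  mk⇔ (evenWheelFree⇒odd-petalNbrs d) (odd-petalNbrs⇒evenWheelFree d) ,
  mk⇔ (λ ehf → odd-petalNbrs⇒evenWheelFree d (evenHoleFree⇒odd-petalNbrs d ehf)
             , ehf (k d) inj₁ C-isHole , evenHoleFree⇒odd-sectors d ehf)
      (λ (ewf , odd-k , odd-sectors) → conditions⇒evenHoleFree d ewf odd-k odd-sectors) ,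
  mk⇔ (λ B → bipartite⇒even-hole B C-isHole , bipartite⇒even-sectors d B)
      (λ (even-k , even-sectors) → Colouring.bipartite d even-k even-sectors)
  where open Daisy d using (C-isHole)
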